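{- Let $G$ be a minimal counterexample, fixed with a plane embedding, as described in the context, and let $f$ be a face of $G$ of degree $d(f)\geq 6$. Then $f$ is incident with at most $\lfloor d(f)/2\rfloor$ vertices of degree 3.
   Context: All graphs are finite and simple. A 2-distance $k$-coloring of a graph $G$ is a map $\phi: V(G)\to\{1,\dots,k\}$ with $\phi(x)\neq\phi(y)$ whenever $x\neq y$ are at distance at most two; $\chi_2(G)$ is the least such $k$. A minimal counterexample is a planar graph $G$ with maximum degree $\Delta(G)\leq 6$ and $\chi_2(G)>20$ such that every planar graph $H$ with $\Delta(H)\leq 6$ and $|V(H)|+|E(H)|<|V(G)|+|E(G)|$ satisfies $\chi_2(H)\leq 20$. The degree $d(f)$ of a face $f$ is the number of edges in its boundary. A face is incident with the vertices on its boundary. -}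

module Defs where

open import Data.Bool using (Bool; true; false; _∧_; _∨_; if_then_else_)
open import Data.Nat using (ℕ; zero; suc; _+_; _*_; _≤_; _<_; _/_; _≡ᵇ_; _<ᵇ_; _≤ᵇ_)
open import Data.Fin using (Fin; toℕ)
open import Data.Fin.Properties using (_≟_)
open import Data.List using (List; []; _∷_; length; filterᵇ; map; allFin; upTo)
open import Data.Product using (Σ; ∃; _×_; _,_; proj₁; proj₂)
open import Data.Sum using (_⊎_)
open import Relation.Nullary using (¬_; does)
open import Relation.Binary.PropositionalEquality using (_≡_; _≢_)
open import Function.Bundles using (_⇔_)

record Graph (n : ℕ) : Set where
  field
    adj   : Fin n → Fin n → Bool
    sym   : ∀ u v → adj u v ≡ adj v u
    irr   : ∀ v → adj v v ≡ false

open Graph public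

module _ {n : ℕ} (G : Graph n) where

  Adj : Fin n → Fin n → Set
  Adj u v = adj G u v ≡ true

  anyB : {A : Set} → (A → Bool) → List A → Bool
  anyB p []       = false
  anyB p (x ∷ xs) = p x ∨ anyB p xs

  allB : {A : Set} → (A → Bool) → List A → Bool
  allB p []       = true
  allB p (x ∷ xs) = p x ∧ allB p xs

  countV : (Fin n → Bool) → ℕ
  countV p = length (filterᵇ p (allFin n))

  countP : (Fin n → Fin n → Bool) → ℕ
  countP p = length (filterᵇ (λ uv → p (proj₁ uv) (proj₂ uv))
                             (Data.List.concatMap (λ u → map (u ,_) (allFin n)) (allFin n)))

  deg : Fin n → ℕ
  deg v = countV (adj G v)

  ∣E∣ : ℕ
  ∣E∣ = countP (λ u v → adj G u v ∧ (toℕ u <ᵇ toℕ v))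

  MaxDeg≤ : ℕ → Set
  MaxDeg≤ k = ∀ v → deg v ≤ k

  Dist≤2 : Fin n → Fin n → Set
  Dist≤2 x y = Adj x y ⊎ ∃ λ z → Adj x z × Adj z y

  TwoDistColorable : ℕ → Set
  TwoDistColorable k =
    Σ (Fin n → Fin k) λ φ → ∀ x y → x ≢ y → Dist≤2 x y → φ x ≢ φ y

  data Reach : Fin n → Fin n → Set where
    here : ∀ {u} → Reach u u
    step : ∀ {u w v} → Adj u w → Reach w v → Reach u v

  -- Combinatorial embeddings (rotation systems)
  -- σ v u = the neighbour of v following u in the cyclic order around v.

  iter : {A : Set} → (A → A) → ℕ → A → A
  iter f zero    x = x
  iter f (suc k) x = f (iter f k x)

  IsRotation : (Fin n → Fin n → Fin n) → Set
  IsRotation σ =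
    (∀ v u → Adj v u → Adj v (σ v u)) ×
    (∀ v u w → Adj v u → Adj v w → ∃ λ k → iter (σ v) k u ≡ w)

  module Faces (σ : Fin n → Fin n → Fin n) where
    Dart : Set
    Dart = Fin n × Fin n

    φ : Dart → Dart
    φ (u , v) = (v , σ v u)

    eqD : Dart → Dart → Bool
    eqD (a , b) (c , d) = does (a ≟ c) ∧ does (b ≟ d)

    inOrbit : Dart → Dart → Bool
    inOrbit d d' = anyB (λ k → eqD (iter φ k d) d') (upTo (n * n))

    rank : Dart → ℕ
    rank (u , v) = toℕ u * n + toℕ v

    isRep : Dart → Bool
    isRep d = allB (λ k → rank d ≤ᵇ rank (iter φ k d)) (upTo (n * n))

    #faces : ℕ
    #faces = countP (λ u v → adj G u v ∧ isRep (u , v))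

    faceDeg : Dart → ℕ
    faceDeg d = countP (λ u v → adj G u v ∧ (toℕ u <ᵇ toℕ v)
                                 ∧ (inOrbit d (u , v) ∨ inOrbit d (v , u)))

    incident : Dart → Fin n → Bool
    incident d w = anyB (λ v → adj G w v ∧ inOrbit d (w , v)) (allFin n)

    #deg3On : Dart → ℕ
    #deg3On d = countV (λ w → incident d w ∧ (deg w ≡ᵇ 3))

  #isolated : ℕ
  #isolated = countV (λ v → deg v ≡ᵇ 0)

  -- σ is a plane embedding: Euler's formula  n - e + f + (#isolated) = 2·(#components)
  -- (genus zero), with components given by a labelling comp.
  IsPlaneRotation : (Fin n → Fin n → Fin n) → Set
  IsPlaneRotation σ =
    IsRotation σ ×
    Σ ℕ λ c → Σ (Fin n → Fin c) λ comp →
      (∀ i → ∃ λ v → comp v ≡ i) ×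
      (∀ u v → (comp u ≡ comp v) ⇔ Reach u v) ×
      (n + Faces.#faces σ + #isolated ≡ ∣E∣ + 2 * c)

  Planar : Set
  Planar = Σ (Fin n → Fin n → Fin n) IsPlaneRotation

MinimalCounterexample : {n : ℕ} → Graph n → Set
MinimalCounterexample {n} G =
  Planar G × MaxDeg≤ G 6 × ¬ TwoDistColorable G 20 ×
  (∀ (m : ℕ) (H : Graph m) → Planar H → MaxDeg≤ H 6 →
     m + ∣E∣ H < n + ∣E∣ G → TwoDistColorable H 20)

-- In a minimal counterexample no two vertices of degree 3 are adjacent. Otherwise delete such an edge
-- xy: the smaller graph G − xy is planar with maximum degree at most 6, so it has a 2-distance
-- 20-colouring, and only the pairs through x or y lose their constraint; recolouring y and then x is
-- possible because each sees at most 3 + 3·5 = 18 vertices within distance two.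
--
-- Planarity is the Euler equation n + f + i = e + 2c of a rotation system (i isolated vertices,
-- c components). Deleting xy from the rotation either merges the two faces on its sides, or splits
-- the face on both sides into two; in the split case xy must be a bridge, because the inequality
-- n + f + i ≤ e + 2c holds for every rotation system, by induction on e using the same surgery.
--
-- Finally, a vertex w of degree 3 on a face contributes the two boundary edges along which the
-- boundary walk enters and leaves w. They differ since deg w ≥ 2, and the edges of different such
-- vertices differ since these vertices are independent; hence twice their number is at most d(f).

module Submission where

open import Defs hiding (sym)
open import Data.Bool using (Bool; true; false; _∧_; _∨_; not; if_then_else_; T)
open import Data.Bool.Properties using (∧-zeroʳ; ∧-identityʳ)
open import Data.Nat using (ℕ; zero; suc; _+_; _*_; _∸_; _≤_; _<_; z≤n; s≤s; s≤s⁻¹; z<s; _≡ᵇ_; _<ᵇ_; _≤ᵇ_; _/_)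
open import Data.Nat.Properties hiding (_≟_)
open import Data.Fin using (Fin; toℕ)
open import Data.Product using (Σ; ∃; _×_; _,_; proj₁; proj₂; uncurry)
open import Data.Sum using (_⊎_; inj₁; inj₂)
open import Data.Empty using (⊥; ⊥-elim)
open import Relation.Nullary using (¬_; Dec; yes; no; does)
open import Data.Fin.Properties using (_≟_)
open import Relation.Binary.PropositionalEquality
open import Function using (_∘_)
open import Relation.Binary.Definitions using (tri<; tri≈; tri>)
open import Relation.Nullary.Decidable using (dec-true; dec-false; _×-dec_; decidable-stable)

false≢true : ¬ false ≡ true
false≢true ()

∧-≡true⁻ : ∀ {a b} → a ∧ b ≡ true → a ≡ true × b ≡ true
∧-≡true⁻ {true} {true} _ = refl , refl

∧-≡true⁺ : ∀ {a b} → a ≡ true → b ≡ true → a ∧ b ≡ true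
∧-≡true⁺ refl refl = refl

T⇒≡true : ∀ {b} → T b → b ≡ true
T⇒≡true {true} _ = refl

≡true⇒T : ∀ {b} → b ≡ true → T b
≡true⇒T refl = _

does-cong : ∀ {P Q : Set} → (P → Q) → (Q → P) → (p? : Dec P) (q? : Dec Q) → does p? ≡ does q?
does-cong P⇒Q Q⇒P (yes p) q? = sym (dec-true q? (P⇒Q p))
does-cong P⇒Q Q⇒P (no ¬p) q? = sym (dec-false q? (¬p ∘ Q⇒P))

-- Defs.iter without its unused graph argument
iterate : {A : Set} → (A → A) → ℕ → A → A
iterate f zero    x = x
iterate f (suc k) x = f (iterate f k x)

module Iteration {A : Set} (f : A → A) where

  iterate-+ : ∀ j k x → iterate f (j + k) x ≡ iterate f j (iterate f k x)
  iterate-+ zero    k x = refl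
  iterate-+ (suc j) k x = cong f (iterate-+ j k x)

  iterate-suc : ∀ k x → iterate f k (f x) ≡ f (iterate f k x)
  iterate-suc zero    x = refl
  iterate-suc (suc k) x = cong f (iterate-suc k x)

  iterate-cong : ∀ {g} → (∀ z → f z ≡ g z) → ∀ k x → iterate f k x ≡ iterate g k x
  iterate-cong f≗g zero    x = refl
  iterate-cong f≗g (suc k) x = trans (cong f (iterate-cong f≗g k x)) (f≗g _)

  iterate-fixed : ∀ {x} → f x ≡ x → ∀ k → iterate f k x ≡ x
  iterate-fixed fx zero    = refl
  iterate-fixed fx (suc k) = trans (cong f (iterate-fixed fx k)) fx

  iterate-* : ∀ {x} P → iterate f P x ≡ x → ∀ t → iterate f (t * P) x ≡ x
  iterate-* P e zero    = refl
  iterate-* {x} P e (suc t) = begin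
    iterate f (P + t * P) x          ≡⟨ iterate-+ P (t * P) x ⟩
    iterate f P (iterate f (t * P) x) ≡⟨ cong (iterate f P) (iterate-* P e t) ⟩
    iterate f P x                    ≡⟨ e ⟩
    x                                ∎
    where open ≡-Reasoning

  -- Both points are fixed by f^(PQ), so f^(PQ-1) undoes f on them.
  periodic-injective : ∀ {u v} P Q → iterate f (suc P) u ≡ u → iterate f (suc Q) v ≡ v →
                       f u ≡ f v → u ≡ v
  periodic-injective {u} {v} P Q eu ev fu≡fv = begin
    u                            ≡⟨ sym (iterate-* (suc P) eu (suc Q)) ⟩
    iterate f (suc Q * suc P) u  ≡⟨ cong (λ t → iterate f t u) (*-comm (suc Q) (suc P)) ⟩
    iterate f (suc K) u          ≡⟨ sym (iterate-suc K u) ⟩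
    iterate f K (f u)            ≡⟨ cong (iterate f K) fu≡fv ⟩
    iterate f K (f v)            ≡⟨ iterate-suc K v ⟩
    iterate f (suc P * suc Q) v  ≡⟨ iterate-* (suc Q) ev (suc P) ⟩
    v                            ∎
    where
    open ≡-Reasoning
    K = Q + P * suc Q

  module Periodic {P x} (fᴾx≡x : iterate f P x ≡ x) (P>0 : 0 < P) where

    reduce : ∀ k → Σ ℕ λ r → r < P × iterate f k x ≡ iterate f r x
    reduce zero = 0 , P>0 , refl
    reduce (suc k) with reduce k
    ... | r , r<P , e with suc r <? P
    ...   | yes r+1<P = suc r , r+1<P , cong f e
    ...   | no  r+1≮P = 0 , P>0 , (begin
      f (iterate f k x)        ≡⟨ cong f e ⟩
      iterate f (suc r) x      ≡⟨ cong (λ t → iterate f t x) (≤-antisym r<P (≮⇒≥ r+1≮P)) ⟩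
      iterate f P x            ≡⟨ fᴾx≡x ⟩
      x                        ∎)
      where open ≡-Reasoning

    back-to-start : ∀ {y} k → iterate f k x ≡ y → Σ ℕ λ k′ → iterate f k′ y ≡ x
    back-to-start {y} k e with reduce k
    ... | r , r<P , e′ = P ∸ r , (begin
      iterate f (P ∸ r) y                  ≡⟨ cong (iterate f (P ∸ r)) (trans (sym e) e′) ⟩
      iterate f (P ∸ r) (iterate f r x)    ≡⟨ sym (iterate-+ (P ∸ r) r x) ⟩
      iterate f (P ∸ r + r) x              ≡⟨ cong (λ t → iterate f t x) (m∸n+n≡m (<⇒≤ r<P)) ⟩
      iterate f P x                        ≡⟨ fᴾx≡x ⟩
      x                                    ∎)
      where open ≡-Reasoning

  module Invariant (I : A → Set) (f-pres : ∀ x → I x → I (f x))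
                   (f-inj : ∀ x y → I x → I y → f x ≡ f y → x ≡ y) where

    iterate-pres : ∀ k x → I x → I (iterate f k x)
    iterate-pres zero    x Ix = Ix
    iterate-pres (suc k) x Ix = f-pres _ (iterate-pres k x Ix)

    iterate-injective : ∀ k x y → I x → I y → iterate f k x ≡ iterate f k y → x ≡ y
    iterate-injective zero    x y Ix Iy e = e
    iterate-injective (suc k) x y Ix Iy e =
      iterate-injective k x y Ix Iy (f-inj _ _ (iterate-pres k x Ix) (iterate-pres k y Iy) e)

  module MinimalPeriod (_≟_ : (u v : A) → Dec (u ≡ v)) (x : A) where

    Returns : ℕ → Set
    Returns j = 0 < j × iterate f j x ≡ x

    firstReturn? : ∀ P → (Σ ℕ λ j → j < P × Returns j) ⊎ (∀ j → j < P → ¬ Returns j)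
    firstReturn? zero = inj₂ λ _ ()
    firstReturn? (suc P) with firstReturn? P
    ... | inj₁ (j , j<P , rj) = inj₁ (j , m<n⇒m<1+n j<P , rj)
    ... | inj₂ none with P | iterate f P x ≟ x
    ...   | zero   | _     = inj₂ λ { j (s≤s z≤n) (() , _) }
    ...   | suc P′ | yes e = inj₁ (suc P′ , ≤-refl , s≤s z≤n , e)
    ...   | suc P′ | no ne = inj₂ λ j j<P → below (m≤n⇒m<n∨m≡n (s≤s⁻¹ j<P))
      where
      below : ∀ {j} → j < suc P′ ⊎ j ≡ suc P′ → ¬ Returns j
      below (inj₁ j<P)  = none _ j<P
      below (inj₂ refl) = ne ∘ proj₂

    minimalPeriod : ∀ P → Returns P →
      Σ ℕ λ Q → Returns Q × (∀ j → j < Q → ¬ Returns j)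
    minimalPeriod = <-rec MinimalBelow shrink
      where
      open import Data.Nat.Induction using (<-rec)
      MinimalBelow : ℕ → Set
      MinimalBelow P = Returns P → Σ ℕ λ Q → Returns Q × (∀ j → j < Q → ¬ Returns j)
      shrink : ∀ P → (∀ {j} → j < P → MinimalBelow j) → MinimalBelow P
      shrink P rec rP with firstReturn? P
      ... | inj₁ (j , j<P , rj) = rec j<P rj
      ... | inj₂ none = P , rP , none

module Counting {A : Set} where

  open import Data.List using (List; []; _∷_; length; filter; filterᵇ; map)
  open import Data.List.Properties using (filter-notAll)
  open import Data.List.Relation.Unary.All.Properties using () renaming (map⁺ to All-map⁺)
  open import Data.List.Membership.Propositional using (_∈_)
  open import Data.List.Membership.Propositional.Properties using (∈-filter⁺; ∈-filter⁻)
  open import Data.List.Relation.Unary.Any as Any using (here; there)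
  open import Data.List.Relation.Unary.All as All using (All; []; _∷_)
  open import Data.List.Relation.Unary.AllPairs using ([]; _∷_)
  open import Data.List.Relation.Unary.Unique.Propositional using (Unique)
  open import Data.List.Relation.Unary.Unique.Propositional.Properties as Unique using ()
  open import Relation.Nullary using (¬?)
  open import Relation.Binary.Definitions using (DecidableEquality)

  count : (A → Bool) → List A → ℕ
  count p xs = length (filterᵇ p xs)

  ∈-filterᵇ⁺ : ∀ (p : A → Bool) {z xs} → z ∈ xs → p z ≡ true → z ∈ filterᵇ p xs
  ∈-filterᵇ⁺ p z∈xs pz = ∈-filter⁺ (Data.Bool.T? ∘ p) z∈xs (≡true⇒T pz)

  ∈-filterᵇ⁻ : ∀ (p : A → Bool) {z xs} → z ∈ filterᵇ p xs → z ∈ xs × p z ≡ true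
  ∈-filterᵇ⁻ p z∈ with ∈-filter⁻ (Data.Bool.T? ∘ p) z∈
  ... | z∈xs , pz = z∈xs , T⇒≡true pz

  count-split : ∀ (p q : A → Bool) xs →
                count p xs ≡ count (λ z → p z ∧ q z) xs + count (λ z → p z ∧ not (q z)) xs
  count-split p q [] = refl
  count-split p q (x ∷ xs) with p x | q x
  ... | true  | true  = cong suc (count-split p q xs)
  ... | true  | false = trans (cong suc (count-split p q xs)) (sym (+-suc _ _))
  ... | false | _     = count-split p q xs

  count-cong : ∀ (p q : A → Bool) xs → (∀ z → z ∈ xs → p z ≡ q z) → count p xs ≡ count q xs
  count-cong p q []       p≗q = refl
  count-cong p q (x ∷ xs) p≗q with p x | q x | p≗q x (here refl)
  ... | true  | true  | _ = cong suc (count-cong p q xs (λ z → p≗q z ∘ there))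
  ... | false | false | _ = count-cong p q xs (λ z → p≗q z ∘ there)

  count-mono : ∀ (p q : A → Bool) xs → (∀ z → p z ≡ true → q z ≡ true) → count p xs ≤ count q xs
  count-mono p q []       p⇒q = z≤n
  count-mono p q (x ∷ xs) p⇒q with p x in px | q x in qx
  ... | true  | true  = s≤s (count-mono p q xs p⇒q)
  ... | false | true  = m≤n⇒m≤1+n (count-mono p q xs p⇒q)
  ... | false | false = count-mono p q xs p⇒q
  ... | true  | false with () ← trans (sym (p⇒q x px)) qx

  count-none : ∀ (p : A → Bool) xs → (∀ z → z ∈ xs → ¬ p z ≡ true) → count p xs ≡ 0
  count-none p []       none = refl
  count-none p (x ∷ xs) none with p x in px
  ... | true  = ⊥-elim (none x (here refl) px)
  ... | false = count-none p xs (λ z → none z ∘ there)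

  count-all : ∀ (p : A → Bool) xs → (∀ z → p z ≡ true) → count p xs ≡ length xs
  count-all p []       all = refl
  count-all p (x ∷ xs) all rewrite all x = cong suc (count-all p xs all)

  count-difference : ∀ (p q : A → Bool) xs → (∀ z → p z ≡ true → q z ≡ true) →
                     count q xs ≡ count p xs + count (λ z → q z ∧ not (p z)) xs
  count-difference p q xs p⇒q =
    trans (count-split q p xs) (cong (_+ count (λ z → q z ∧ not (p z)) xs) (count-cong _ p xs λ z _ → q∧p≡p z))
    where
    q∧p≡p : ∀ z → q z ∧ p z ≡ p z
    q∧p≡p z with p z in pz
    ... | true  = trans (∧-identityʳ (q z)) (p⇒q z pz)
    ... | false = ∧-zeroʳ (q z)

  unique-map-on : ∀ {B : Set} (f : A → B) (Q : A → Set) {xs} → All Q xs → Unique xs →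
                  (∀ {a b} → Q a → Q b → f a ≡ f b → a ≡ b) → Unique (map f xs)
  unique-map-on f Q [] [] f-inj = []
  unique-map-on f Q (qx ∷ qxs) (x∉xs ∷ uxs) f-inj =
    All-map⁺ (All.zipWith (λ (x≢y , qy) fx≡fy → x≢y (f-inj qx qy fx≡fy)) (x∉xs , qxs)) ∷ unique-map-on f Q qxs uxs f-inj

  count>0⇒witness : ∀ (p : A → Bool) xs → 0 < count p xs → Σ A λ z → p z ≡ true
  count>0⇒witness p (x ∷ xs) pos with p x in px
  ... | true  = x , px
  ... | false = count>0⇒witness p xs pos

  module WithDecidableEquality (_≟_ : DecidableEquality A) where

    unique-⊆⇒length≤ : ∀ {xs} ys → Unique xs → (∀ {z} → z ∈ xs → z ∈ ys) → length xs ≤ length ys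
    unique-⊆⇒length≤ {[]}     ys _              _      = z≤n
    unique-⊆⇒length≤ {x ∷ xs} ys (x∉xs ∷ uxs) xs⊆ys =
      ≤-trans (s≤s (unique-⊆⇒length≤ (filter ≢x? ys) uxs xs⊆ys-x))
              (filter-notAll ≢x? ys (Any.map (λ x≡z z≢x → z≢x (sym x≡z)) (xs⊆ys (here refl))))
      where
      ≢x? = λ z → ¬? (z ≟ x)
      xs⊆ys-x : ∀ {z} → z ∈ xs → z ∈ filter ≢x? ys
      xs⊆ys-x z∈xs = ∈-filter⁺ ≢x? (xs⊆ys (there z∈xs)) (λ z≡x → All.lookup x∉xs z∈xs (sym z≡x))

    count≤length-of-cover : ∀ (p : A → Bool) xs ys → Unique xs → (∀ z → z ∈ xs → p z ≡ true → z ∈ ys) →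
                            count p xs ≤ length ys
    count≤length-of-cover p xs ys uxs cover =
      unique-⊆⇒length≤ ys (Unique.filter⁺ (Data.Bool.T? ∘ p) uxs)
        (λ z∈ → let z∈xs , pz = ∈-filterᵇ⁻ p z∈ in cover _ z∈xs pz)

    length≤count : ∀ (p : A → Bool) xs ys → Unique ys → (∀ z → z ∈ ys → z ∈ xs × p z ≡ true) →
                   length ys ≤ count p xs
    length≤count p xs ys uys sub =
      unique-⊆⇒length≤ (filterᵇ p xs) uys (λ z∈ys → let z∈xs , pz = sub _ z∈ys in ∈-filterᵇ⁺ p z∈xs pz)

    count≤1 : ∀ (p : A → Bool) xs → Unique xs → (∀ z w → p z ≡ true → p w ≡ true → z ≡ w) → count p xs ≤ 1
    count≤1 p [] _ _ = z≤n
    count≤1 p (x ∷ xs) (x∉xs ∷ uxs) unique with p x in px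
    ... | false = count≤1 p xs uxs unique
    ... | true  = s≤s (≤-reflexive (count-none p xs λ z z∈xs pz → All.lookup x∉xs z∈xs (unique x z px pz)))

    count≥1 : ∀ (p : A → Bool) xs z → z ∈ xs → p z ≡ true → 1 ≤ count p xs
    count≥1 p xs z z∈xs pz = length≤count p xs (z ∷ []) ([] ∷ []) λ { _ (here refl) → z∈xs , pz }

    count≥2 : ∀ (p : A → Bool) xs z w → z ∈ xs → p z ≡ true → w ∈ xs → p w ≡ true → ¬ z ≡ w →
              2 ≤ count p xs
    count≥2 p xs z w z∈xs pz w∈xs pw z≢w =
      length≤count p xs (z ∷ w ∷ []) ((z≢w ∷ []) ∷ [] ∷ [])
        λ { _ (here refl) → z∈xs , pz ; _ (there (here refl)) → w∈xs , pw }

    count≤2 : ∀ (p : A → Bool) xs z w → Unique xs → (∀ v → p v ≡ true → v ≡ z ⊎ v ≡ w) → count p xs ≤ 2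
    count≤2 p xs z w uxs two = count≤length-of-cover p xs (z ∷ w ∷ []) uxs λ v _ pv → listed (two v pv)
      where
      listed : ∀ {v} → v ≡ z ⊎ v ≡ w → v ∈ z ∷ w ∷ []
      listed (inj₁ refl) = here refl
      listed (inj₂ refl) = there (here refl)

    count-remove : ∀ (p : A → Bool) xs z → Unique xs → z ∈ xs → p z ≡ true →
                   count p xs ≡ suc (count (λ v → p v ∧ not (does (v ≟ z))) xs)
    count-remove p xs z uxs z∈xs pz =
      trans (count-split p (λ v → does (v ≟ z)) xs) (cong (_+ count (λ v → p v ∧ not (does (v ≟ z))) xs)
        (≤-antisym (count≤1 _ xs uxs λ u v pu pv → trans (is-z u pu) (sym (is-z v pv)))
                   (count≥1 _ xs z z∈xs z-counted)))
      where
      is-z : ∀ v → p v ∧ does (v ≟ z) ≡ true → v ≡ z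
      is-z v pv with v ≟ z
      ... | yes v≡z = v≡z
      ... | no  _   = ⊥-elim (false≢true (proj₂ (∧-≡true⁻ {p v} pv)))
      z-counted : p z ∧ does (z ≟ z) ≡ true
      z-counted with z ≟ z
      ... | yes _  = trans (∧-identityʳ (p z)) pz
      ... | no z≢z = ⊥-elim (z≢z refl)

module VertexPairs (n : ℕ) where

  open import Data.Fin using (Fin)
  open import Data.List using (List; []; _∷_; _++_; map; concatMap; allFin; cartesianProduct)
  open import Data.List.Membership.Propositional using (_∈_)
  open import Data.List.Membership.Propositional.Properties using (∈-allFin; ∈-cartesianProduct⁺)
  open import Data.List.Relation.Unary.Unique.Propositional using (Unique)
  open import Data.List.Relation.Unary.Unique.Propositional.Properties using (allFin⁺; cartesianProduct⁺)

  pairs : List (Fin n × Fin n)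
  pairs = concatMap (λ u → map (u ,_) (allFin n)) (allFin n)

  concatMap-pairs≡cartesianProduct : ∀ {A B : Set} (xs : List A) (ys : List B) →
    concatMap (λ u → map (u ,_) ys) xs ≡ cartesianProduct xs ys
  concatMap-pairs≡cartesianProduct []       ys = refl
  concatMap-pairs≡cartesianProduct (x ∷ xs) ys = cong (map (x ,_) ys ++_) (concatMap-pairs≡cartesianProduct xs ys)

  pairs-unique : Unique pairs
  pairs-unique = subst Unique (sym (concatMap-pairs≡cartesianProduct (allFin n) (allFin n)))
                   (cartesianProduct⁺ (allFin⁺ n) (allFin⁺ n))

  ∈-pairs : ∀ d → d ∈ pairs
  ∈-pairs (u , v) = subst ((u , v) ∈_) (sym (concatMap-pairs≡cartesianProduct (allFin n) (allFin n)))
                      (∈-cartesianProduct⁺ (∈-allFin u) (∈-allFin v))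

_≟ᵈ_ : ∀ {n} (d d′ : Fin n × Fin n) → Dec (d ≡ d′)
_≟ᵈ_ = ≡-dec _≟_ _≟_
  where open import Data.Product.Properties using (≡-dec)

module VertexCounting {n : ℕ} = Counting.WithDecidableEquality (_≟_ {n})
module DartCounting {n : ℕ} = Counting.WithDecidableEquality (_≟ᵈ_ {n})

module GraphFacts {n : ℕ} (G : Graph n) where

  open import Data.Fin using (Fin)
  open import Data.List using (List; []; _∷_)
  open import Data.List.Membership.Propositional using (_∈_)
  open import Data.List.Relation.Unary.Any using (here; there)

  Adj-sym : ∀ {u v} → Adj G u v → Adj G v u
  Adj-sym {u} {v} a = trans (sym (Graph.sym G u v)) a

  Adj-irrefl : ∀ {v} → ¬ Adj G v v
  Adj-irrefl {v} a = false≢true (trans (sym (irr G v)) a)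

  Adj⇒≢ : ∀ {u v} → Adj G u v → ¬ u ≡ v
  Adj⇒≢ a refl = Adj-irrefl a

  isEdge : Fin n × Fin n → Bool
  isEdge (u , v) = adj G u v ∧ (toℕ u <ᵇ toℕ v)

  iter≡iterate : ∀ {A : Set} (f : A → A) k x → iter G f k x ≡ iterate f k x
  iter≡iterate f zero    x = refl
  iter≡iterate f (suc k) x = cong f (iter≡iterate f k x)

  anyB⇒witness : ∀ {A : Set} (p : A → Bool) xs → anyB G p xs ≡ true → Σ A λ x → x ∈ xs × p x ≡ true
  anyB⇒witness p (x ∷ xs) e with p x in px
  ... | true  = x , here refl , px
  ... | false = let y , y∈xs , py = anyB⇒witness p xs e in y , there y∈xs , py

  witness⇒anyB : ∀ {A : Set} (p : A → Bool) xs x → x ∈ xs → p x ≡ true → anyB G p xs ≡ true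
  witness⇒anyB p (y ∷ xs) x (here refl) px rewrite px = refl
  witness⇒anyB p (y ∷ xs) x (there x∈xs) px with p y
  ... | true  = refl
  ... | false = witness⇒anyB p xs x x∈xs px

  allB⇒all : ∀ {A : Set} (p : A → Bool) xs → allB G p xs ≡ true → ∀ x → x ∈ xs → p x ≡ true
  allB⇒all p (y ∷ xs) e x x∈ with p y in py
  allB⇒all p (y ∷ xs) e x (here refl)  | true = py
  allB⇒all p (y ∷ xs) e x (there x∈xs) | true = allB⇒all p xs e x x∈xs

  all⇒allB : ∀ {A : Set} (p : A → Bool) xs → (∀ x → x ∈ xs → p x ≡ true) → allB G p xs ≡ true
  all⇒allB p []       all = refl
  all⇒allB p (y ∷ xs) all rewrite all y (here refl) = all⇒allB p xs (λ x → all x ∘ there)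

-- Faces of a rotation system

module RotationSystem {n : ℕ} (G : Graph n) (σ : Fin n → Fin n → Fin n) (rot : IsRotation G σ) where

  open import Data.Fin using (combine)
  open import Data.Fin.Properties using (pigeonhole; toℕ-injective; toℕ<n; combine-injective; toℕ-combine)
  open import Data.List using (List; map; upTo)
  open import Data.List.Membership.Propositional using (_∈_)
  open import Data.List.Membership.Propositional.Properties using (∈-upTo⁺; ∈-map⁺; ∈-map⁻)
  open import Data.List.Relation.Unary.All as All using ()
  open import Data.List.Extrema ≤-totalOrder using (argmin; argmin-all; f[argmin]≤f[xs])

  open Faces G σ public
  open GraphFacts G

  IsDart : Dart → Set
  IsDart (u , v) = Adj G u v

  σ-period : ∀ {v u} → Adj G v u → Σ ℕ λ m → iterate (σ v) (suc m) u ≡ u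
  σ-period {v} {u} a with proj₂ rot v (σ v u) u (proj₁ rot v u a) a
  ... | k , e = k , trans (sym (iterate-suc k u)) (trans (sym (iter≡iterate (σ v) k (σ v u))) e)
    where open Iteration (σ v)

  σ-injective : ∀ {v u w} → Adj G v u → Adj G v w → σ v u ≡ σ v w → u ≡ w
  σ-injective {v} au aw with σ-period au | σ-period aw
  ... | P , σᴾ⁺¹u≡u | Q , σ^Q+1w≡w = periodic-injective P Q σᴾ⁺¹u≡u σ^Q+1w≡w
    where open Iteration (σ v)

  σ-iterate-neighbour : ∀ {v u} → Adj G v u → ∀ k → Adj G v (iterate (σ v) k u)
  σ-iterate-neighbour avu zero    = avu
  σ-iterate-neighbour avu (suc k) = proj₁ rot _ _ (σ-iterate-neighbour avu k)

  σ-fixed⇒sole-neighbour : ∀ {v t u} → Adj G v t → σ v t ≡ t → Adj G v u → u ≡ t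
  σ-fixed⇒sole-neighbour {v} {t} {u} avt σvt≡t avu with proj₂ rot v t u avt avu
  ... | k , e = trans (sym e) (trans (iter≡iterate (σ v) k t) (iterate-fixed σvt≡t k))
    where open Iteration (σ v)

  φ-dart : ∀ d → IsDart d → IsDart (φ d)
  φ-dart (u , v) a = proj₁ rot v u (Adj-sym a)

  φ-injective : ∀ d d′ → IsDart d → IsDart d′ → φ d ≡ φ d′ → d ≡ d′
  φ-injective (u , v) (u′ , v′) a a′ e with cong proj₁ e
  ... | refl = cong (_, v) (σ-injective (Adj-sym a) (Adj-sym a′) (cong proj₂ e))

  open Iteration φ public
  open Invariant IsDart φ-dart φ-injective public

  N : ℕ
  N = n * n

  code : Dart → Fin N
  code (u , v) = combine u v

  code-injective : ∀ d d′ → code d ≡ code d′ → d ≡ d′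
  code-injective (u , v) (u′ , v′) e with combine-injective u v u′ v′ e
  ... | refl , refl = refl

  rank≡code : ∀ d → rank d ≡ toℕ (code d)
  rank≡code (u , v) = trans (cong (_+ toℕ v) (*-comm (toℕ u) n)) (sym (toℕ-combine u v))

  rank-injective : ∀ d d′ → rank d ≡ rank d′ → d ≡ d′
  rank-injective d d′ e = code-injective d d′ (toℕ-injective (trans (sym (rank≡code d)) (trans e (rank≡code d′))))

  -- Among the N + 1 darts φ⁰ d, …, φᴺ d two coincide, and φ is injective on darts.
  period : ∀ d → IsDart d → Σ ℕ λ P → 0 < P × P ≤ N × iterate φ P d ≡ d
  period d isd with pigeonhole ≤-refl (λ (i : Fin (suc N)) → code (iterate φ (toℕ i) d))
  ... | i , j , i<j , e = P , m<n⇒0<n∸m i<j , ≤-trans (m∸n≤m (toℕ j) (toℕ i)) (s≤s⁻¹ (toℕ<n j)) , sym d≡φᴾd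
    where
    P = toℕ j ∸ toℕ i
    φⁱd≡φⁱφᴾd : iterate φ (toℕ i) d ≡ iterate φ (toℕ i) (iterate φ P d)
    φⁱd≡φⁱφᴾd = begin
      iterate φ (toℕ i) d                   ≡⟨ code-injective _ _ e ⟩
      iterate φ (toℕ j) d                   ≡⟨ cong (λ t → iterate φ t d) (sym (m+[n∸m]≡n (<⇒≤ i<j))) ⟩
      iterate φ (toℕ i + P) d               ≡⟨ iterate-+ (toℕ i) P d ⟩
      iterate φ (toℕ i) (iterate φ P d)     ∎
      where open ≡-Reasoning
    d≡φᴾd = iterate-injective (toℕ i) d (iterate φ P d) isd (iterate-pres P d isd) φⁱd≡φⁱφᴾd

  SameFace : Dart → Dart → Set
  SameFace d d′ = Σ ℕ λ k → iterate φ k d ≡ d′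

  SameFace-refl : ∀ d → SameFace d d
  SameFace-refl d = 0 , refl

  SameFace-trans : ∀ {d d′ d″} → SameFace d d′ → SameFace d′ d″ → SameFace d d″
  SameFace-trans {d} (k , e) (k′ , e′) = k′ + k , trans (iterate-+ k′ k d) (trans (cong (iterate φ k′) e) e′)

  SameFace-sym : ∀ {d d′} → IsDart d → SameFace d d′ → SameFace d′ d
  SameFace-sym {d} isd (k , e) with period d isd
  ... | P , P>0 , _ , φᴾd≡d = Periodic.back-to-start φᴾd≡d P>0 k e

  SameFace-dart : ∀ {d d′} → IsDart d → SameFace d d′ → IsDart d′
  SameFace-dart {d} isd (k , refl) = iterate-pres k d isd

  -- Defs.inOrbit and Defs.isRep only inspect the first N iterates of φ, which suffices by this bound.
  SameFace-bounded : ∀ {d d′} → IsDart d → SameFace d d′ → Σ ℕ λ k → k < N × iterate φ k d ≡ d′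
  SameFace-bounded {d} isd (k , e) with period d isd
  ... | P , P>0 , P≤N , φᴾd≡d with Periodic.reduce φᴾd≡d P>0 k
  ... | r , r<P , e′ = r , ≤-trans r<P P≤N , trans (sym e′) e

  eqD⇒≡ : ∀ d d′ → eqD d d′ ≡ true → d ≡ d′
  eqD⇒≡ (a , b) (c , d) e with a ≟ c | b ≟ d | e
  ... | yes refl | yes refl | _ = refl

  eqD-refl : ∀ d → eqD d d ≡ true
  eqD-refl (a , b) with a ≟ a | b ≟ b
  ... | yes _ | yes _ = refl
  ... | no a≢a | _ = ⊥-elim (a≢a refl)
  ... | yes _ | no b≢b = ⊥-elim (b≢b refl)

  inOrbit⇒SameFace : ∀ d d′ → inOrbit d d′ ≡ true → SameFace d d′
  inOrbit⇒SameFace d d′ e with anyB⇒witness (λ k → eqD (iter G φ k d) d′) (upTo N) e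
  ... | k , _ , ek = k , trans (sym (iter≡iterate φ k d)) (eqD⇒≡ _ _ ek)

  SameFace⇒inOrbit : ∀ d d′ → IsDart d → SameFace d d′ → inOrbit d d′ ≡ true
  SameFace⇒inOrbit d d′ isd sf with SameFace-bounded isd sf
  ... | k , k<N , ek = witness⇒anyB (λ k → eqD (iter G φ k d) d′) (upTo N) k (∈-upTo⁺ k<N)
        (subst (λ z → eqD z d′ ≡ true) (sym (trans (iter≡iterate φ k d) ek)) (eqD-refl d′))

  SameFace? : ∀ d d′ → IsDart d → Dec (SameFace d d′)
  SameFace? d d′ isd with inOrbit d d′ in e
  ... | true  = yes (inOrbit⇒SameFace d d′ e)
  ... | false = no λ sf → false≢true (trans (sym e) (SameFace⇒inOrbit d d′ isd sf))

  IsMinimal : Dart → Set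
  IsMinimal d = ∀ d′ → SameFace d d′ → rank d ≤ rank d′

  isRep⇒minimal : ∀ d → IsDart d → isRep d ≡ true → IsMinimal d
  isRep⇒minimal d isd e d′ sf with SameFace-bounded isd sf
  ... | k , k<N , ek = subst (λ z → rank d ≤ rank z) (trans (iter≡iterate φ k d) ek)
        (≤ᵇ⇒≤ _ _ (≡true⇒T (allB⇒all (λ k → rank d ≤ᵇ rank (iter G φ k d)) (upTo N) e k (∈-upTo⁺ k<N))))

  minimal⇒isRep : ∀ d → IsMinimal d → isRep d ≡ true
  minimal⇒isRep d min = all⇒allB (λ k → rank d ≤ᵇ rank (iter G φ k d)) (upTo N)
    λ k _ → T⇒≡true (≤⇒≤ᵇ (min _ (k , sym (iter≡iterate φ k d))))

  isRep-unique : ∀ r r′ → IsDart r → SameFace r r′ → isRep r ≡ true → isRep r′ ≡ true → r ≡ r′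
  isRep-unique r r′ isr sf e e′ = rank-injective r r′
    (≤-antisym (isRep⇒minimal r isr e r′ sf)
               (isRep⇒minimal r′ (SameFace-dart isr sf) e′ r (SameFace-sym isr sf)))

  face : Dart → List Dart
  face d = map (λ k → iterate φ k d) (upTo N)

  rep : Dart → Dart
  rep d = argmin rank d (face d)

  SameFace-rep : ∀ d → SameFace d (rep d)
  SameFace-rep d = argmin-all rank {xs = face d} {P = SameFace d} (SameFace-refl d)
    (All.tabulate λ d′∈ → let k , _ , e = ∈-map⁻ (λ k → iterate φ k d) {xs = upTo N} d′∈ in k , sym e)

  isRep-rep : ∀ d → IsDart d → isRep (rep d) ≡ true
  isRep-rep d isd = minimal⇒isRep (rep d) λ d′ sf →
    let k , k<N , e = SameFace-bounded isd (SameFace-trans (SameFace-rep d) sf)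
    in subst (λ z → rank (rep d) ≤ rank z) e
         (All.lookup (f[argmin]≤f[xs] {f = rank} d (face d)) (∈-map⁺ (λ k → iterate φ k d) (∈-upTo⁺ k<N)))

  isRep⇒≡rep : ∀ c d → IsDart c → SameFace c d → isRep d ≡ true → d ≡ rep c
  isRep⇒≡rep c d isc sf isRepd = sym (isRep-unique (rep c) d (SameFace-dart isc (SameFace-rep c))
    (SameFace-trans (SameFace-sym isc (SameFace-rep c)) sf) (isRep-rep c isc) isRepd)

module SkipPoint {A : Set} (_≟ᴬ_ : (u v : A) → Dec (u ≡ v)) (s : A → A) (b : A) where

  open Iteration

  skip : A → A
  skip u = if does (s u ≟ᴬ b) then s b else s u

  skip-hit : ∀ {u} → s u ≡ b → skip u ≡ s b
  skip-hit {u} su≡b with s u ≟ᴬ b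
  ... | yes _    = refl
  ... | no su≢b = ⊥-elim (su≢b su≡b)

  skip-miss : ∀ {u} → ¬ s u ≡ b → skip u ≡ s u
  skip-miss {u} su≢b with s u ≟ᴬ b
  ... | yes su≡b = ⊥-elim (su≢b su≡b)
  ... | no _     = refl

  skip-step : ∀ {u w} k → skip u ≡ w → iterate skip k w ≡ iterate skip (suc k) u
  skip-step {u} k refl = iterate-suc skip k u

  skip-path : ∀ k {u w} → iterate s k u ≡ w → ¬ u ≡ b → ¬ w ≡ b → Σ ℕ λ k′ → iterate skip k′ u ≡ w
  skip-path zero e _ _ = 0 , e
  skip-path (suc k) {u} {w} e u≢b w≢b with s u ≟ᴬ b
  ... | no su≢b =
    let k′ , e′ = skip-path k (trans (iterate-suc s k u) e) su≢b w≢b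
    in suc k′ , trans (sym (skip-step k′ (skip-miss su≢b))) e′
  skip-path (suc zero) e u≢b w≢b | yes su≡b = ⊥-elim (w≢b (trans (sym e) su≡b))
  skip-path (suc (suc k)) {u} {w} e u≢b w≢b | yes su≡b with s b ≟ᴬ b
  ... | yes sb≡b = ⊥-elim (w≢b (trans (sym e) (begin
    iterate s (suc (suc k)) u  ≡⟨ sym (iterate-suc s (suc k) u) ⟩
    iterate s (suc k) (s u)    ≡⟨ cong (iterate s (suc k)) su≡b ⟩
    iterate s (suc k) b        ≡⟨ iterate-fixed s sb≡b (suc k) ⟩
    b                          ∎)))
    where open ≡-Reasoning
  ... | no sb≢b =
    let k′ , e′ = skip-path k (begin
          iterate s k (s b)          ≡⟨ cong (λ z → iterate s k (s z)) (sym su≡b) ⟩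
          iterate s k (s (s u))      ≡⟨ iterate-suc s k (s u) ⟩
          s (iterate s k (s u))      ≡⟨ cong s (iterate-suc s k u) ⟩
          iterate s (suc (suc k)) u  ≡⟨ e ⟩
          w                          ∎) sb≢b w≢b
    in suc k′ , trans (sym (skip-step k′ (skip-hit su≡b))) e′
    where open ≡-Reasoning

module EdgeDeletion {n : ℕ} (G : Graph n) (x y : Fin n) (axy : Adj G x y) where

  open import Relation.Nullary.Decidable using (_⊎-dec_)
  open import Data.Sum using ([_,_]′) renaming (swap to ⊎-swap)
  open import Data.Product using () renaming (swap to ×-swap)
  open import Data.List using (allFin)
  open import Data.List.Membership.Propositional.Properties using (∈-allFin)
  open import Data.List.Relation.Unary.Unique.Propositional.Properties using (allFin⁺)
  open GraphFacts G
  open Counting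
  open VertexCounting

  x≢y : ¬ x ≡ y
  x≢y = Adj⇒≢ axy

  ayx : Adj G y x
  ayx = Adj-sym axy

  IsXY : Fin n → Fin n → Set
  IsXY u v = (u ≡ x × v ≡ y) ⊎ (u ≡ y × v ≡ x)

  xy? : ∀ u v → Dec (IsXY u v)
  xy? u v = (u ≟ x ×-dec v ≟ y) ⊎-dec (u ≟ y ×-dec v ≟ x)

  IsXY-sym : ∀ {u v} → IsXY u v → IsXY v u
  IsXY-sym = ⊎-swap ∘ Data.Sum.map ×-swap ×-swap

  isXY-sym : ∀ u v → does (xy? u v) ≡ does (xy? v u)
  isXY-sym u v = does-cong IsXY-sym IsXY-sym (xy? u v) (xy? v u)

  G′ : Graph n
  G′ = record
    { adj = λ u v → adj G u v ∧ not (does (xy? u v))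
    ; sym = λ u v → cong₂ (λ p q → p ∧ not q) (Graph.sym G u v) (isXY-sym u v)
    ; irr = λ v → cong (_∧ not (does (xy? v v))) (irr G v)
    }

  Adj′⁻ : ∀ {u v} → Adj G′ u v → Adj G u v × ¬ IsXY u v
  Adj′⁻ {u} {v} a′ with ∧-≡true⁻ {adj G u v} a′
  ... | a , ¬xy = a , λ p → false≢true (trans (cong not (sym (dec-true (xy? u v) p))) ¬xy)

  Adj′⁺ : ∀ {u v} → Adj G u v → ¬ IsXY u v → Adj G′ u v
  Adj′⁺ {u} {v} a ¬p = ∧-≡true⁺ a (cong not (dec-false (xy? u v) ¬p))

  Adj′⇒Adj : ∀ {u v} → Adj G′ u v → Adj G u v
  Adj′⇒Adj = proj₁ ∘ Adj′⁻

  IsXY-x : ∀ {w} → IsXY x w → w ≡ y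
  IsXY-x (inj₁ (_ , w≡y)) = w≡y
  IsXY-x (inj₂ (x≡y , _)) = ⊥-elim (x≢y x≡y)

  IsXY-y : ∀ {w} → IsXY y w → w ≡ x
  IsXY-y (inj₁ (y≡x , _)) = ⊥-elim (x≢y (sym y≡x))
  IsXY-y (inj₂ (_ , w≡x)) = w≡x

  IsXY-other : ∀ {v w} → ¬ v ≡ x → ¬ v ≡ y → ¬ IsXY v w
  IsXY-other v≢x v≢y = [ v≢x ∘ proj₁ , v≢y ∘ proj₁ ]′

  module Endpoint (p q : Fin n) (apq : Adj G p q) (IsXY-p : ∀ {w} → IsXY p w → w ≡ q)
                  (q-IsXY : IsXY p q) where

    Adj′-p⁻ : ∀ {w} → Adj G′ p w → Adj G p w × ¬ w ≡ q
    Adj′-p⁻ a′ = let a , ¬xy = Adj′⁻ a′ in a , λ { refl → ¬xy q-IsXY }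

    Adj′-p⁺ : ∀ {w} → Adj G p w → ¬ w ≡ q → Adj G′ p w
    Adj′-p⁺ a w≢q = Adj′⁺ a (w≢q ∘ IsXY-p)

    deg-endpoint : deg G p ≡ suc (deg G′ p)
    deg-endpoint = trans (count-remove (adj G p) (allFin n) q (allFin⁺ n) (∈-allFin q) apq)
      (cong suc (count-cong _ (adj G′ p) (allFin n) λ w _ →
        cong (λ t → adj G p w ∧ not t) (does-cong (λ { refl → q-IsXY }) IsXY-p (w ≟ q) (xy? p w))))

  module X = Endpoint x y axy IsXY-x (inj₁ (refl , refl))
  module Y = Endpoint y x ayx IsXY-y (inj₂ (refl , refl))

  data Position (v : Fin n) : Set where
    at-x  : v ≡ x → Position v
    at-y  : v ≡ y → Position v
    other : ¬ v ≡ x → ¬ v ≡ y → Position v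

  position : ∀ v → Position v
  position v with v ≟ x | v ≟ y
  ... | yes v≡x | _       = at-x v≡x
  ... | no _    | yes v≡y = at-y v≡y
  ... | no v≢x  | no v≢y  = other v≢x v≢y

  adj′≡adj : ∀ {u v} → ¬ IsXY u v → adj G′ u v ≡ adj G u v
  adj′≡adj {u} {v} ¬xy = trans (cong (λ t → adj G u v ∧ not t) (dec-false (xy? u v) ¬xy)) (∧-identityʳ _)

  deg′≤deg : ∀ v → deg G′ v ≤ deg G v
  deg′≤deg v = count-mono (adj G′ v) (adj G v) (allFin n) (λ _ → Adj′⇒Adj)

  deg′-other : ∀ {v} → ¬ v ≡ x → ¬ v ≡ y → deg G′ v ≡ deg G v
  deg′-other v≢x v≢y = count-cong _ _ (allFin n) λ w _ → adj′≡adj (IsXY-other v≢x v≢y)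

  ∣E∣-delete : toℕ x < toℕ y → ∣E∣ G ≡ suc (∣E∣ G′)
  ∣E∣-delete x<y =
    trans (DartCounting.count-remove isEdge pairs (x , y) pairs-unique (∈-pairs (x , y)) xy-counted)
          (cong suc (count-cong _ (GraphFacts.isEdge G′) pairs λ d _ → sym (isEdge′ d)))
    where
    open VertexPairs n
    xy-counted : isEdge (x , y) ≡ true
    xy-counted = ∧-≡true⁺ axy (T⇒≡true (<⇒<ᵇ x<y))
    ordered-IsXY : ∀ {u v} → toℕ u < toℕ v → IsXY u v → (u , v) ≡ (x , y)
    ordered-IsXY u<v (inj₁ (refl , refl)) = refl
    ordered-IsXY u<v (inj₂ (refl , refl)) = ⊥-elim (<-asym u<v x<y)
    isEdge′ : ∀ d → GraphFacts.isEdge G′ d ≡ isEdge d ∧ not (does (d ≟ᵈ (x , y)))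
    isEdge′ (u , v) with toℕ u <ᵇ toℕ v in u<ᵇv
    ... | false = trans (∧-zeroʳ _) (cong (_∧ not (does ((u , v) ≟ᵈ (x , y)))) (sym (∧-zeroʳ (adj G u v))))
    ... | true  = begin
      (adj G u v ∧ not (does (xy? u v))) ∧ true            ≡⟨ ∧-identityʳ _ ⟩
      adj G u v ∧ not (does (xy? u v))                     ≡⟨ cong (λ t → adj G u v ∧ not t) same-test ⟩
      adj G u v ∧ not (does ((u , v) ≟ᵈ (x , y)))          ≡⟨ cong (_∧ not (does ((u , v) ≟ᵈ (x , y))))
                                                                   (sym (∧-identityʳ (adj G u v))) ⟩
      (adj G u v ∧ true) ∧ not (does ((u , v) ≟ᵈ (x , y))) ∎
      where
      open ≡-Reasoning
      u<v = <ᵇ⇒< (toℕ u) (toℕ v) (≡true⇒T u<ᵇv)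
      same-test = does-cong (ordered-IsXY u<v) (λ { refl → inj₁ (refl , refl) }) (xy? u v) ((u , v) ≟ᵈ (x , y))

  isolated⇒isolated′ : ∀ v → (deg G v ≡ᵇ 0) ≡ true → (deg G′ v ≡ᵇ 0) ≡ true
  isolated⇒isolated′ v isol with deg G v | deg′≤deg v
  ... | zero | d′≤0 rewrite n≤0⇒n≡0 d′≤0 = refl

  NewlyIsolated : Fin n → Bool
  NewlyIsolated v = (deg G′ v ≡ᵇ 0) ∧ not (deg G v ≡ᵇ 0)

  newly-isolated : ∀ {v} → deg G′ v ≡ 0 → deg G v ≡ suc (deg G′ v) → NewlyIsolated v ≡ true
  newly-isolated d′≡0 d≡1+d′ rewrite d≡1+d′ | d′≡0 = refl

  isolated-gain : ∀ k → k ≤ count NewlyIsolated (allFin n) → #isolated G + k ≤ #isolated G′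
  isolated-gain k k≤ = subst (#isolated G + k ≤_)
    (sym (count-difference _ (λ v → deg G′ v ≡ᵇ 0) (allFin n) isolated⇒isolated′)) (+-monoʳ-≤ _ k≤)

  isolated-mono : #isolated G ≤ #isolated G′
  isolated-mono = subst (_≤ #isolated G′) (+-identityʳ _) (isolated-gain 0 z≤n)

  isolated-x : deg G′ x ≡ 0 → #isolated G + 1 ≤ #isolated G′
  isolated-x d′x≡0 = isolated-gain 1 (count≥1 _ (allFin n) x (∈-allFin x) (newly-isolated d′x≡0 X.deg-endpoint))

  isolated-y : deg G′ y ≡ 0 → #isolated G + 1 ≤ #isolated G′
  isolated-y d′y≡0 = isolated-gain 1 (count≥1 _ (allFin n) y (∈-allFin y) (newly-isolated d′y≡0 Y.deg-endpoint))

  isolated-xy : deg G′ x ≡ 0 → deg G′ y ≡ 0 → #isolated G + 2 ≤ #isolated G′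
  isolated-xy d′x≡0 d′y≡0 = isolated-gain 2 (count≥2 _ (allFin n) x y
    (∈-allFin x) (newly-isolated d′x≡0 X.deg-endpoint) (∈-allFin y) (newly-isolated d′y≡0 Y.deg-endpoint) x≢y)

  isolated-unchanged : 1 < deg G x → 1 < deg G y → #isolated G′ ≡ #isolated G
  isolated-unchanged 1<dx 1<dy = count-cong _ _ (allFin n) λ v _ → same v (position v)
    where
    positive : ∀ {m} → 0 < m → (m ≡ᵇ 0) ≡ false
    positive (s≤s _) = refl
    endpoint : ∀ {v} → 1 < deg G v → deg G v ≡ suc (deg G′ v) → (deg G′ v ≡ᵇ 0) ≡ (deg G v ≡ᵇ 0)
    endpoint 1<d d≡1+d′ = trans (positive (s≤s⁻¹ (subst (1 <_) d≡1+d′ 1<d))) (sym (positive (<-trans z<s 1<d)))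
    same : ∀ v → Position v → (deg G′ v ≡ᵇ 0) ≡ (deg G v ≡ᵇ 0)
    same v (at-x refl) = endpoint 1<dx X.deg-endpoint
    same v (at-y refl) = endpoint 1<dy Y.deg-endpoint
    same v (other v≢x v≢y) = cong (_≡ᵇ 0) (deg′-other v≢x v≢y)

  module Rotation (σ : Fin n → Fin n → Fin n) (rot : IsRotation G σ) where

    open RotationSystem G σ rot

    -- the rotation at an endpoint p of the deleted edge pq skips q
    module SkipEnd (p q : Fin n) (apq : Adj G p q) (IsXY-p : ∀ {w} → IsXY p w → w ≡ q) (q-IsXY : IsXY p q) where

      open Endpoint p q apq IsXY-p q-IsXY
      open SkipPoint _≟_ (σ p) q public

      skip-Adj′ : ∀ {u} → Adj G′ p u → Adj G′ p (skip u)
      skip-Adj′ {u} a′ = neighbour (σ p u ≟ q)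
        where
        apu = proj₁ (Adj′-p⁻ a′)
        u≢q = proj₂ (Adj′-p⁻ a′)
        neighbour : Dec (σ p u ≡ q) → Adj G′ p (skip u)
        neighbour (yes σpu≡q) = subst (Adj G′ p) (sym (skip-hit σpu≡q))
          (Adj′-p⁺ (proj₁ rot p q apq) λ σpq≡q → u≢q (σ-injective apu apq (trans σpu≡q (sym σpq≡q))))
        neighbour (no σpu≢q) = subst (Adj G′ p) (sym (skip-miss σpu≢q)) (Adj′-p⁺ (proj₁ rot p u apu) σpu≢q)

      σ-fixes-q⇒deg′≡0 : σ p q ≡ q → deg G′ p ≡ 0
      σ-fixes-q⇒deg′≡0 σpq≡q = count-none (adj G′ p) (allFin n) λ w _ a′ →
        let apw , w≢q = Adj′-p⁻ a′ in w≢q (σ-fixed⇒sole-neighbour apq σpq≡q apw)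

      skip-transitive : ∀ {u w} → Adj G′ p u → Adj G′ p w → Σ ℕ λ k → iterate skip k u ≡ w
      skip-transitive {u} {w} a′ a″ =
        let apu , u≢q = Adj′-p⁻ a′
            apw , w≢q = Adj′-p⁻ a″
            k , e = proj₂ rot p u w apu apw
        in skip-path k (trans (sym (iter≡iterate (σ p) k u)) e) u≢q w≢q

    module SkipX = SkipEnd x y axy IsXY-x (inj₁ (refl , refl))
    module SkipY = SkipEnd y x ayx IsXY-y (inj₂ (refl , refl))

    σ′ : Fin n → Fin n → Fin n
    σ′ v u with v ≟ x | v ≟ y
    ... | yes _ | _     = SkipX.skip u
    ... | no _  | yes _ = SkipY.skip u
    ... | no _  | no _  = σ v u

    σ′-x : ∀ u → σ′ x u ≡ SkipX.skip u
    σ′-x u with x ≟ x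
    ... | yes _  = refl
    ... | no x≢x = ⊥-elim (x≢x refl)

    σ′-y : ∀ u → σ′ y u ≡ SkipY.skip u
    σ′-y u with y ≟ x | y ≟ y
    ... | yes y≡x | _      = ⊥-elim (x≢y (sym y≡x))
    ... | no _    | yes _  = refl
    ... | no _    | no y≢y = ⊥-elim (y≢y refl)

    σ′-other : ∀ {v} u → ¬ v ≡ x → ¬ v ≡ y → σ′ v u ≡ σ v u
    σ′-other {v} u v≢x v≢y with v ≟ x | v ≟ y
    ... | yes v≡x | _       = ⊥-elim (v≢x v≡x)
    ... | no _    | yes v≡y = ⊥-elim (v≢y v≡y)
    ... | no _    | no _    = refl

    σ′-neighbour : ∀ v u → Adj G′ v u → Adj G′ v (σ′ v u)
    σ′-neighbour v u a′ with position v
    ... | at-x refl = subst (Adj G′ x) (sym (σ′-x u)) (SkipX.skip-Adj′ a′)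
    ... | at-y refl = subst (Adj G′ y) (sym (σ′-y u)) (SkipY.skip-Adj′ a′)
    ... | other v≢x v≢y = subst (Adj G′ v) (sym (σ′-other u v≢x v≢y))
                            (Adj′⁺ (proj₁ rot v u (Adj′⇒Adj a′)) (IsXY-other v≢x v≢y))

    σ′-transitive : ∀ v u w → Adj G′ v u → Adj G′ v w → Σ ℕ λ k → iter G′ (σ′ v) k u ≡ w
    σ′-transitive v u w a′ a″ with position v
    ... | at-x refl = let k , e = SkipX.skip-transitive a′ a″ in
          k , trans (GraphFacts.iter≡iterate G′ (σ′ x) k u) (trans (Iteration.iterate-cong (σ′ x) σ′-x k u) e)
    ... | at-y refl = let k , e = SkipY.skip-transitive a′ a″ in
          k , trans (GraphFacts.iter≡iterate G′ (σ′ y) k u) (trans (Iteration.iterate-cong (σ′ y) σ′-y k u) e)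
    ... | other v≢x v≢y = let k , e = proj₂ rot v u w (Adj′⇒Adj a′) (Adj′⇒Adj a″) in
          k , trans (GraphFacts.iter≡iterate G′ (σ′ v) k u)
                (trans (Iteration.iterate-cong (σ′ v) (λ z → σ′-other z v≢x v≢y) k u)
                       (trans (sym (iter≡iterate (σ v) k u)) e))

    rot′ : IsRotation G′ σ′
    rot′ = σ′-neighbour , σ′-transitive

    module R′ = RotationSystem G′ σ′ rot′

    a b : Dart
    a = x , y
    b = y , x

    φ′-before-a : ∀ e → φ e ≡ a → R′.φ e ≡ φ b
    φ′-before-a (u , v) φe≡a with cong proj₁ φe≡a | cong proj₂ φe≡a
    ... | refl | σxu≡y = cong (x ,_) (trans (σ′-x u) (SkipX.skip-hit σxu≡y))

    φ′-before-b : ∀ e → φ e ≡ b → R′.φ e ≡ φ a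
    φ′-before-b (u , v) φe≡b with cong proj₁ φe≡b | cong proj₂ φe≡b
    ... | refl | σyu≡x = cong (y ,_) (trans (σ′-y u) (SkipY.skip-hit σyu≡x))

    φ′-elsewhere : ∀ e → ¬ φ e ≡ a → ¬ φ e ≡ b → R′.φ e ≡ φ e
    φ′-elsewhere (u , v) φe≢a φe≢b with position v
    ... | at-x refl = cong (x ,_) (trans (σ′-x u) (SkipX.skip-miss (φe≢a ∘ cong (x ,_))))
    ... | at-y refl = cong (y ,_) (trans (σ′-y u) (SkipY.skip-miss (φe≢b ∘ cong (y ,_))))
    ... | other v≢x v≢y = cong (v ,_) (σ′-other u v≢x v≢y)

-- Cutting two points out of a permutation

-- g is f with a and b cut out of their cycles and the two gaps reconnected crosswise: this merges the
-- cycles of a and b when they differ, and splits their common cycle otherwise.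
module CycleSurgery {A : Set} (_≟ᴬ_ : (u v : A) → Dec (u ≡ v)) (f g : A → A) (I : A → Set)
  (f-pres : ∀ x → I x → I (f x)) (f-inj : ∀ x y → I x → I y → f x ≡ f y → x ≡ y)
  (periodic : ∀ x → I x → Σ ℕ λ P → 0 < P × iterate f P x ≡ x)
  (a b : A) (Ia : I a) (Ib : I b) (a≢b : ¬ a ≡ b) (fa≢a : ¬ f a ≡ a) (fb≢b : ¬ f b ≡ b)
  (g-before-a : ∀ e → f e ≡ a → g e ≡ f b)
  (g-before-b : ∀ e → f e ≡ b → g e ≡ f a)
  (g-elsewhere : ∀ e → ¬ f e ≡ a → ¬ f e ≡ b → g e ≡ f e) where

  open Iteration f
  open Invariant I f-pres f-inj
  open ≡-Reasoning

  Rf Rg : A → A → Set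
  Rf d d′ = Σ ℕ λ k → iterate f k d ≡ d′
  Rg d d′ = Σ ℕ λ k → iterate g k d ≡ d′

  Rf-trans : ∀ {d d′ d″} → Rf d d′ → Rf d′ d″ → Rf d d″
  Rf-trans {d} (k , e) (k′ , e′) = k′ + k , trans (iterate-+ k′ k d) (trans (cong (iterate f k′) e) e′)

  Rg-trans : ∀ {d d′ d″} → Rg d d′ → Rg d′ d″ → Rg d d″
  Rg-trans {d} (k , e) (k′ , e′) = k′ + k , trans (Iteration.iterate-+ g k′ k d) (trans (cong (iterate g k′) e) e′)

  Rf-sym : ∀ {d d′} → I d → Rf d d′ → Rf d′ d
  Rf-sym {d} Id (k , e) = let P , P>0 , fᴾd≡d = periodic d Id in Periodic.back-to-start fᴾd≡d P>0 k e

  Avoids : A → Set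
  Avoids e = ¬ e ≡ a × ¬ e ≡ b

  g-agrees : ∀ e k → (∀ i → i < k → Avoids (iterate f (suc i) e)) → iterate g k e ≡ iterate f k e
  g-agrees e zero    _  = refl
  g-agrees e (suc k) av = begin
    g (iterate g k e) ≡⟨ cong g (g-agrees e k (λ i i<k → av i (m<n⇒m<1+n i<k))) ⟩
    g (iterate f k e) ≡⟨ uncurry (g-elsewhere _) (av k ≤-refl) ⟩
    f (iterate f k e) ∎

  off-orbit : ∀ {c e} → I e → ¬ Rf c e → ∀ t → ¬ iterate f t e ≡ c
  off-orbit Ie c↛e t fᵗe≡c = c↛e (Rf-sym Ie (t , fᵗe≡c))

  -- g runs through the f-arc strictly between p and f^ℓ p like f, and then jumps to next
  module Arc (p : A) (ℓ : ℕ) (avoids : ∀ t → 0 < t → t < ℓ → Avoids (iterate f t p))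
             (next : A) (exit : ∀ e → f e ≡ iterate f ℓ p → g e ≡ next) where

    InArc : A → Set
    InArc e = Σ ℕ λ t → 0 < t × t < ℓ × iterate f t p ≡ e

    InArc⇒Avoids : ∀ {e} → InArc e → Avoids e
    InArc⇒Avoids (t , 0<t , t<ℓ , refl) = avoids t 0<t t<ℓ

    path : ∀ {i j} → 0 < i → i ≤ j → j < ℓ → Rg (iterate f i p) (iterate f j p)
    path {i} {j} 0<i i≤j j<ℓ = j ∸ i , (begin
      iterate g (j ∸ i) (iterate f i p) ≡⟨ g-agrees _ (j ∸ i) inside ⟩
      iterate f (j ∸ i) (iterate f i p) ≡⟨ sym (iterate-+ (j ∸ i) i p) ⟩
      iterate f (j ∸ i + i) p           ≡⟨ cong (λ t → iterate f t p) (m∸n+n≡m i≤j) ⟩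
      iterate f j p                     ∎)
      where
      inside : ∀ t → t < j ∸ i → Avoids (iterate f (suc t) (iterate f i p))
      inside t t<j∸i = subst Avoids (iterate-+ (suc t) i p)
        (avoids (suc t + i) z<s (≤-<-trans (≤-trans (+-monoˡ-≤ i t<j∸i) (≤-reflexive (m∸n+n≡m i≤j))) j<ℓ))

    first : 1 < ℓ → InArc (f p)
    first 1<ℓ = 1 , z<s , 1<ℓ , refl

    last : 1 < ℓ → Σ A λ e → InArc e × f e ≡ iterate f ℓ p
    last (s≤s (s≤s (z≤n {k}))) = iterate f (suc k) p , (suc k , z<s , ≤-refl , refl) , refl

    from-first : ∀ {e} → InArc e → Rg (f p) e
    from-first (t , 0<t , t<ℓ , refl) = path z<s 0<t t<ℓ

    to-next : ∀ {e} → InArc e → Rg e next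
    to-next (t , 0<t , t<ℓ@(s≤s t≤ℓ-1) , refl) =
      Rg-trans (path 0<t t≤ℓ-1 ≤-refl) (1 , exit _ refl)

    advance : ∀ {e} → InArc e → InArc (g e) ⊎ g e ≡ next
    advance (t , 0<t , t<ℓ , refl) with suc t <? ℓ
    ... | yes t+1<ℓ = inj₁ (suc t , z<s , t+1<ℓ ,
                        sym (uncurry (g-elsewhere _) (avoids (suc t) z<s t+1<ℓ)))
    ... | no  t+1≮ℓ = inj₂ (exit _ (cong (λ s → iterate f s p) (≤-antisym t<ℓ (≮⇒≥ t+1≮ℓ))))

    -- when g leaves the arc where it entered, the arc is a whole cycle of g
    module Cycle (next≡fp : next ≡ f p) (1<ℓ : 1 < ℓ) where

      closed : ∀ k → InArc (iterate g k (f p))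
      closed zero    = first 1<ℓ
      closed (suc k) with advance (closed k)
      ... | inj₁ inArc = inArc
      ... | inj₂ g≡next = subst InArc (sym (trans g≡next next≡fp)) (first 1<ℓ)

      connected : ∀ {e} → InArc e → Rg (f p) e × Rg e (f p)
      connected inArc = from-first inArc , subst (Rg _) next≡fp (to-next inArc)

  module Orbit (c : A) (Ic : I c) where

    private
      minimal = MinimalPeriod.minimalPeriod _≟ᴬ_ c _ (proj₂ (periodic c Ic))

    P : ℕ
    P = proj₁ minimal

    P>0 : 0 < P
    P>0 = proj₁ (proj₁ (proj₂ minimal))

    fᴾc≡c : iterate f P c ≡ c
    fᴾc≡c = proj₂ (proj₁ (proj₂ minimal))

    no-early-return : ∀ t → 0 < t → t < P → ¬ iterate f t c ≡ c
    no-early-return t 0<t t<P e = proj₂ (proj₂ minimal) t t<P (0<t , e)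

    private
      early : ∀ {i j} → i < j → j < P → ¬ iterate f i c ≡ iterate f j c
      early {i} {j} i<j j<P e = no-early-return (j ∸ i) (m<n⇒0<n∸m i<j) (≤-<-trans (m∸n≤m j i) j<P)
        (sym (iterate-injective i c (iterate f (j ∸ i) c) Ic (iterate-pres (j ∸ i) c Ic) (begin
          iterate f i c                     ≡⟨ e ⟩
          iterate f j c                     ≡⟨ cong (λ t → iterate f t c) (sym (m+[n∸m]≡n (<⇒≤ i<j))) ⟩
          iterate f (i + (j ∸ i)) c         ≡⟨ iterate-+ i (j ∸ i) c ⟩
          iterate f i (iterate f (j ∸ i) c) ∎)))

    index-injective : ∀ {i j} → i < P → j < P → iterate f i c ≡ iterate f j c → i ≡ j
    index-injective {i} {j} i<P j<P e with <-cmp i j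
    ... | tri≈ _ i≡j _ = i≡j
    ... | tri< i<j _ _ = ⊥-elim (early i<j j<P e)
    ... | tri> _ _ j<i = ⊥-elim (early j<i i<P (sym e))

    index : ∀ {e} → Rf c e → Σ ℕ λ j → j < P × iterate f j c ≡ e
    index (k , e) = let r , r<P , e′ = Periodic.reduce fᴾc≡c P>0 k in r , r<P , trans (sym e′) e

    1<P : ¬ f c ≡ c → 1 < P
    1<P fc≢c with m≤n⇒m<n∨m≡n P>0
    ... | inj₁ 1<P = 1<P
    ... | inj₂ 1≡P = ⊥-elim (fc≢c (subst (λ t → iterate f t c ≡ c) (sym 1≡P) fᴾc≡c))

  module OrbitA = Orbit a Ia
  module OrbitB = Orbit b Ib

  module Merge (a↛b : ¬ Rf a b) where

    b↛a : ¬ Rf b a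
    b↛a b→a = a↛b (Rf-sym Ib b→a)

    module ArcA = Arc a OrbitA.P (λ t 0<t t<P → OrbitA.no-early-return t 0<t t<P , λ e → a↛b (t , e))
                      (f b) (λ e fe≡a → g-before-a e (trans fe≡a OrbitA.fᴾc≡c))
    module ArcB = Arc b OrbitB.P (λ t 0<t t<P → (λ e → b↛a (t , e)) , OrbitB.no-early-return t 0<t t<P)
                      (f a) (λ e fe≡b → g-before-b e (trans fe≡b OrbitB.fᴾc≡c))

    InMerged : A → Set
    InMerged e = ArcA.InArc e ⊎ ArcB.InArc e

    first-a : ArcA.InArc (f a)
    first-a = ArcA.first (OrbitA.1<P fa≢a)

    first-b : ArcB.InArc (f b)
    first-b = ArcB.first (OrbitB.1<P fb≢b)

    closed : ∀ k → InMerged (iterate g k (f a))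
    closed zero = inj₁ first-a
    closed (suc k) with closed k
    ... | inj₁ inA with ArcA.advance inA
    ...   | inj₁ inA′ = inj₁ inA′
    ...   | inj₂ g≡fb = inj₂ (subst ArcB.InArc (sym g≡fb) first-b)
    closed (suc k) | inj₂ inB with ArcB.advance inB
    ...   | inj₁ inB′ = inj₂ inB′
    ...   | inj₂ g≡fa = inj₁ (subst ArcA.InArc (sym g≡fa) first-a)

    connected : ∀ {e} → InMerged e → Rg (f a) e × Rg e (f a)
    connected (inj₁ inA) = ArcA.from-first inA , Rg-trans (ArcA.to-next inA) (ArcB.to-next first-b)
    connected (inj₂ inB) = Rg-trans (ArcA.to-next first-a) (ArcB.from-first inB) , ArcB.to-next inB

    covered : ∀ {e} → Rf a e ⊎ Rf b e → Avoids e → InMerged e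
    covered (inj₁ a→e) (e≢a , _) with OrbitA.index a→e
    ... | zero  , _   , e≡a  = ⊥-elim (e≢a (sym e≡a))
    ... | suc j , j<P , fʲa≡e = inj₁ (suc j , z<s , j<P , fʲa≡e)
    covered (inj₂ b→e) (_ , e≢b) with OrbitB.index b→e
    ... | zero  , _   , e≡b  = ⊥-elim (e≢b (sym e≡b))
    ... | suc j , j<P , fʲb≡e = inj₂ (suc j , z<s , j<P , fʲb≡e)

    merged⇒orbit : ∀ {e} → InMerged e → Rf a e ⊎ Rf b e
    merged⇒orbit (inj₁ (t , _ , _ , fᵗa≡e)) = inj₁ (t , fᵗa≡e)
    merged⇒orbit (inj₂ (t , _ , _ , fᵗb≡e)) = inj₂ (t , fᵗb≡e)

    merged⇒avoids : ∀ {e} → InMerged e → Avoids e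
    merged⇒avoids (inj₁ inA) = ArcA.InArc⇒Avoids inA
    merged⇒avoids (inj₂ inB) = ArcB.InArc⇒Avoids inB

    predecessor-of-a : Σ A λ e → Rg (f a) e × f e ≡ a
    predecessor-of-a with ArcA.last (OrbitA.1<P fa≢a)
    ... | e , inA , fe≡fᴾa = e , ArcA.from-first inA , trans fe≡fᴾa OrbitA.fᴾc≡c

    unchanged : ∀ {e} → I e → ¬ Rf a e → ¬ Rf b e → ∀ k → iterate g k e ≡ iterate f k e
    unchanged Ie a↛e b↛e k = g-agrees _ k λ i _ → off-orbit Ie a↛e (suc i) , off-orbit Ie b↛e (suc i)

  module Split (a→b : Rf a b) where

    open OrbitA using (P; fᴾc≡c; no-early-return; index-injective)

    m : ℕ
    m = proj₁ (OrbitA.index a→b)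

    m<P : m < P
    m<P = proj₁ (proj₂ (OrbitA.index a→b))

    fᵐa≡b : iterate f m a ≡ b
    fᵐa≡b = proj₂ (proj₂ (OrbitA.index a→b))

    0<m : 0 < m
    0<m with m | fᵐa≡b
    ... | zero  | a≡b = ⊥-elim (a≢b a≡b)
    ... | suc _ | _   = z<s

    fᵗb≡fᵗ⁺ᵐa : ∀ t → iterate f t b ≡ iterate f (t + m) a
    fᵗb≡fᵗ⁺ᵐa t = trans (cong (iterate f t) (sym fᵐa≡b)) (sym (iterate-+ t m a))

    fᴾ⁻ᵐb≡a : iterate f (P ∸ m) b ≡ a
    fᴾ⁻ᵐb≡a = trans (fᵗb≡fᵗ⁺ᵐa (P ∸ m)) (trans (cong (λ t → iterate f t a) (m∸n+n≡m (<⇒≤ m<P))) fᴾc≡c)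

    ≢b : ∀ {t} → t < P → ¬ t ≡ m → ¬ iterate f t a ≡ b
    ≢b t<P t≢m fᵗa≡b = t≢m (index-injective t<P m<P (trans fᵗa≡b (sym fᵐa≡b)))

    avoidsA : ∀ t → 0 < t → t < m → Avoids (iterate f t a)
    avoidsA t 0<t t<m = no-early-return t 0<t (<-trans t<m m<P) , ≢b (<-trans t<m m<P) (<⇒≢ t<m)

    avoidsB : ∀ t → 0 < t → t < P ∸ m → Avoids (iterate f t b)
    avoidsB t 0<t t<P∸m = subst Avoids (sym (fᵗb≡fᵗ⁺ᵐa t))
      (no-early-return (t + m) (<-≤-trans 0<t (m≤m+n t m)) t+m<P ,
       ≢b t+m<P (λ t+m≡m → <⇒≢ 0<t (sym (+-cancelʳ-≡ m t 0 t+m≡m))))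
      where
      t+m<P : t + m < P
      t+m<P = subst (t + m <_) (m∸n+n≡m (<⇒≤ m<P)) (+-monoˡ-< m t<P∸m)

    module ArcA = Arc a m avoidsA (f a) (λ e fe≡fᵐa → g-before-b e (trans fe≡fᵐa fᵐa≡b))
    module ArcB = Arc b (P ∸ m) avoidsB (f b) (λ e fe≡fᴾ⁻ᵐb → g-before-a e (trans fe≡fᴾ⁻ᵐb fᴾ⁻ᵐb≡a))

    covered : ∀ {e} → Rf a e → Avoids e → ArcA.InArc e ⊎ ArcB.InArc e
    covered a→e (e≢a , e≢b) with OrbitA.index a→e
    ... | zero , _ , e≡a = ⊥-elim (e≢a (sym e≡a))
    ... | j@(suc _) , j<P , fʲa≡e with <-cmp j m
    ...   | tri< j<m _ _ = inj₁ (j , z<s , j<m , fʲa≡e)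
    ...   | tri≈ _ j≡m _ = ⊥-elim (e≢b (trans (sym fʲa≡e) (subst (λ t → iterate f t a ≡ b) (sym j≡m) fᵐa≡b)))
    ...   | tri> _ _ m<j = inj₂ (j ∸ m , m<n⇒0<n∸m m<j , ∸-monoˡ-< j<P (<⇒≤ m<j) , (begin
      iterate f (j ∸ m) b       ≡⟨ fᵗb≡fᵗ⁺ᵐa (j ∸ m) ⟩
      iterate f (j ∸ m + m) a   ≡⟨ cong (λ t → iterate f t a) (m∸n+n≡m (<⇒≤ m<j)) ⟩
      iterate f j a             ≡⟨ fʲa≡e ⟩
      _                         ∎))

    disjoint : ∀ {e} → ArcA.InArc e → ¬ ArcB.InArc e
    disjoint (t , _ , t<m , fᵗa≡e) (t′ , _ , t′<P∸m , fᵗ′b≡e) =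
      <⇒≢ (<-≤-trans t<m (m≤n+m m t′))
          (index-injective (<-trans t<m m<P) (subst (t′ + m <_) (m∸n+n≡m (<⇒≤ m<P)) (+-monoˡ-< m t′<P∸m))
            (trans fᵗa≡e (trans (sym fᵗ′b≡e) (fᵗb≡fᵗ⁺ᵐa t′))))

    arcA-empty : ¬ 1 < m → f a ≡ b
    arcA-empty m≯1 = subst (λ t → iterate f t a ≡ b) (≤-antisym (≮⇒≥ m≯1) 0<m) fᵐa≡b

    arcB-empty : ¬ 1 < P ∸ m → f b ≡ a
    arcB-empty P∸m≯1 = subst (λ t → iterate f t b ≡ a) (≤-antisym (≮⇒≥ P∸m≯1) (m<n⇒0<n∸m m<P)) fᴾ⁻ᵐb≡a

    unchanged : ∀ {e} → I e → ¬ Rf a e → ∀ k → iterate g k e ≡ iterate f k e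
    unchanged Ie a↛e k = g-agrees _ k λ i _ →
      off-orbit Ie a↛e (suc i) , off-orbit Ie (λ b→e → a↛e (Rf-trans a→b b→e)) (suc i)

module FacesAfterDeletion {n : ℕ} (G : Graph n) (σ : Fin n → Fin n → Fin n) (rot : IsRotation G σ)
                          (x y : Fin n) (axy : Adj G x y) where

  open import Data.Bool.Properties using (∨-zeroʳ; ⇔→≡)
  open import Function.Bundles using (mk⇔)
  open EdgeDeletion G x y axy public
  open Rotation σ rot public
  open RotationSystem G σ rot public
  open VertexPairs n
  open Counting
  open DartCounting

  a≢b : ¬ a ≡ b
  a≢b = x≢y ∘ cong proj₁

  φa≢a : ¬ φ a ≡ a
  φa≢a = x≢y ∘ sym ∘ cong proj₁

  φb≢b : ¬ φ b ≡ b
  φb≢b = x≢y ∘ cong proj₁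

  periodic : ∀ d → IsDart d → Σ ℕ λ P → 0 < P × iterate φ P d ≡ d
  periodic d isd = let P , P>0 , _ , φᴾd≡d = period d isd in P , P>0 , φᴾd≡d

  module S = CycleSurgery _≟ᵈ_ φ R′.φ IsDart φ-dart φ-injective periodic a b axy ayx a≢b φa≢a φb≢b
                          φ′-before-a φ′-before-b φ′-elsewhere

  dart′⁺ : ∀ {d} → IsDart d → S.Avoids d → R′.IsDart d
  dart′⁺ isd (d≢a , d≢b) = Adj′⁺ isd λ { (inj₁ (refl , refl)) → d≢a refl ; (inj₂ (refl , refl)) → d≢b refl }

  dart′⁻ : ∀ {d} → R′.IsDart d → IsDart d × S.Avoids d
  dart′⁻ isd′ = let isd , ¬xy = Adj′⁻ isd′ in
    isd , (λ { refl → ¬xy (inj₁ (refl , refl)) }) , (λ { refl → ¬xy (inj₂ (refl , refl)) })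

  FaceRep FaceRep′ : Dart → Bool
  FaceRep  (u , v) = adj G  u v ∧ isRep (u , v)
  FaceRep′ (u , v) = adj G′ u v ∧ R′.isRep (u , v)

  #faces′ : ℕ
  #faces′ = R′.#faces

  FaceRep-unchanged : ∀ d → (IsDart d → S.Avoids d × (∀ k → iterate R′.φ k d ≡ iterate φ k d)) →
                      FaceRep d ≡ FaceRep′ d
  FaceRep-unchanged (u , v) unchanged = ⇔→≡ {z = true} (mk⇔
    (λ r → let isd , isr = ∧-≡true⁻ {adj G u v} r
               avoids , same = unchanged isd
           in ∧-≡true⁺ (dart′⁺ isd avoids) (R′.minimal⇒isRep _ λ d′ (k , e) →
                isRep⇒minimal _ isd isr d′ (k , trans (sym (same k)) e)))
    (λ r′ → let isd′ , isr′ = ∧-≡true⁻ {adj G′ u v} r′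
                isd = Adj′⇒Adj isd′
                same = proj₂ (unchanged isd)
            in ∧-≡true⁺ isd (minimal⇒isRep _ λ d′ (k , e) →
                R′.isRep⇒minimal _ isd′ isr′ d′ (k , trans (same k) e))))

  -- Faces are counted by their representative darts; Q must contain every dart whose status changes.
  faces-exchange : ∀ (Q : Dart → Bool) → (∀ d → Q d ≡ false → FaceRep d ≡ FaceRep′ d) →
                   #faces + count (λ d → FaceRep′ d ∧ Q d) pairs ≡ #faces′ + count (λ d → FaceRep d ∧ Q d) pairs
  faces-exchange Q agree = begin
    #faces + new              ≡⟨ cong (_+ new) (count-split FaceRep Q pairs) ⟩
    old + rest + new          ≡⟨ cong (λ r → old + r + new) (count-cong _ _ pairs λ d _ → off-Q d) ⟩
    old + rest′ + new         ≡⟨ +-assoc old rest′ new ⟩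
    old + (rest′ + new)       ≡⟨ cong (old +_) (+-comm rest′ new) ⟩
    old + (new + rest′)       ≡⟨ cong (old +_) (sym (count-split FaceRep′ Q pairs)) ⟩
    old + #faces′             ≡⟨ +-comm old #faces′ ⟩
    #faces′ + old             ∎
    where
    open ≡-Reasoning
    new = count (λ d → FaceRep′ d ∧ Q d) pairs
    old = count (λ d → FaceRep d ∧ Q d) pairs
    rest = count (λ d → FaceRep d ∧ not (Q d)) pairs
    rest′ = count (λ d → FaceRep′ d ∧ not (Q d)) pairs
    off-Q : ∀ d → FaceRep d ∧ not (Q d) ≡ FaceRep′ d ∧ not (Q d)
    off-Q d with Q d in qd
    ... | true  = trans (∧-zeroʳ (FaceRep d)) (sym (∧-zeroʳ (FaceRep′ d)))
    ... | false = cong (_∧ true) (agree d qd)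

  rep-counted : ∀ {c} (Q : Dart → Bool) → IsDart c → Q (rep c) ≡ true → FaceRep (rep c) ∧ Q (rep c) ≡ true
  rep-counted {c} Q isc q = ∧-≡true⁺ (∧-≡true⁺ (SameFace-dart isc (SameFace-rep c)) (isRep-rep c isc)) q

  rep′-counted : ∀ {c} (Q : Dart → Bool) → R′.IsDart c → Q (R′.rep c) ≡ true →
                 FaceRep′ (R′.rep c) ∧ Q (R′.rep c) ≡ true
  rep′-counted {c} Q isc q = ∧-≡true⁺ (∧-≡true⁺ (R′.SameFace-dart isc (R′.SameFace-rep c)) (R′.isRep-rep c isc)) q

  module Merged (a↛b : ¬ SameFace a b) where

    open S.Merge a↛b

    OnAB : Dart → Bool
    OnAB d = inOrbit a d ∨ inOrbit b d

    OnAB⇒orbit : ∀ d → OnAB d ≡ true → SameFace a d ⊎ SameFace b d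
    OnAB⇒orbit d e with inOrbit a d in ea
    ... | true  = inj₁ (inOrbit⇒SameFace a d ea)
    ... | false = inj₂ (inOrbit⇒SameFace b d e)

    orbit⇒OnAB : ∀ d → SameFace a d ⊎ SameFace b d → OnAB d ≡ true
    orbit⇒OnAB d (inj₁ sf) rewrite SameFace⇒inOrbit a d axy sf = refl
    orbit⇒OnAB d (inj₂ sf) rewrite SameFace⇒inOrbit b d ayx sf = ∨-zeroʳ (inOrbit a d)

    off-OnAB : ∀ d → OnAB d ≡ false → FaceRep d ≡ FaceRep′ d
    off-OnAB d e = FaceRep-unchanged d λ isd →
      ((λ { refl → a↛d (SameFace-refl a) }) , (λ { refl → b↛d (SameFace-refl b) })) , unchanged isd a↛d b↛d
      where
      a↛d : ¬ SameFace a d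
      a↛d sf = false≢true (trans (sym e) (orbit⇒OnAB d (inj₁ sf)))
      b↛d : ¬ SameFace b d
      b↛d sf = false≢true (trans (sym e) (orbit⇒OnAB d (inj₂ sf)))

    old-faces : count (λ d → FaceRep d ∧ OnAB d) pairs ≡ 2
    old-faces = ≤-antisym
      (count≤2 _ pairs (rep a) (rep b) pairs-unique λ d counted →
        let fr , on = ∧-≡true⁻ {FaceRep d} counted
            isd , isr = ∧-≡true⁻ {adj G (proj₁ d) (proj₂ d)} fr
        in Data.Sum.map (λ sf → isRep⇒≡rep a d axy sf isr) (λ sf → isRep⇒≡rep b d ayx sf isr) (OnAB⇒orbit d on))
      (count≥2 _ pairs (rep a) (rep b)
        (∈-pairs _) (rep-counted OnAB axy (orbit⇒OnAB _ (inj₁ (SameFace-rep a))))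
        (∈-pairs _) (rep-counted OnAB ayx (orbit⇒OnAB _ (inj₂ (SameFace-rep b))))
        λ ra≡rb → a↛b (SameFace-trans (SameFace-rep a)
                        (subst (λ r → SameFace r b) (sym ra≡rb) (SameFace-sym ayx (SameFace-rep b)))))

    φa′ : R′.IsDart (φ a)
    φa′ = dart′⁺ (φ-dart a axy) (merged⇒avoids (inj₁ first-a))

    new-faces : count (λ d → FaceRep′ d ∧ OnAB d) pairs ≡ 1
    new-faces = ≤-antisym
      (count≤1 _ pairs pairs-unique λ d d′ cd cd′ → trans (counted≡rep d cd) (sym (counted≡rep d′ cd′)))
      (count≥1 _ pairs (R′.rep (φ a)) (∈-pairs _) (rep′-counted OnAB φa′ (orbit⇒OnAB _ (merged⇒orbit
        (subst InMerged (proj₂ (R′.SameFace-rep (φ a))) (closed (proj₁ (R′.SameFace-rep (φ a)))))))))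
      where
      counted≡rep : ∀ d → FaceRep′ d ∧ OnAB d ≡ true → d ≡ R′.rep (φ a)
      counted≡rep d counted =
        let fr , on = ∧-≡true⁻ {FaceRep′ d} counted
            isd′ , isr = ∧-≡true⁻ {adj G′ (proj₁ d) (proj₂ d)} fr
            _ , avoids = dart′⁻ isd′
        in R′.isRep⇒≡rep (φ a) d φa′ (proj₁ (connected (covered (OnAB⇒orbit d on) avoids))) isr

    faces-merge : #faces ≡ #faces′ + 1
    faces-merge = +-cancelʳ-≡ 1 #faces (#faces′ + 1) (begin
      #faces + 1        ≡⟨ cong (#faces +_) (sym new-faces) ⟩
      #faces + _        ≡⟨ faces-exchange OnAB off-OnAB ⟩
      #faces′ + _       ≡⟨ cong (#faces′ +_) old-faces ⟩
      #faces′ + 2       ≡⟨ sym (+-assoc #faces′ 1 1) ⟩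
      #faces′ + 1 + 1   ∎)
      where open ≡-Reasoning

  private
    interchange : ∀ {i i′ j k l} → i + l ≤ i′ → j ≤ k → i + (j + l) ≤ k + i′
    interchange {i} {i′} {j} {k} {l} i+l≤i′ j≤k = begin
      i + (j + l)   ≡⟨ sym (+-assoc i j l) ⟩
      i + j + l     ≡⟨ cong (_+ l) (+-comm i j) ⟩
      j + i + l     ≡⟨ +-assoc j i l ⟩
      j + (i + l)   ≤⟨ +-mono-≤ j≤k i+l≤i′ ⟩
      k + i′        ∎
      where open ≤-Reasoning

  module Split (a→b : SameFace a b) where

    open S.Split a→b

    OnA : Dart → Bool
    OnA d = inOrbit a d

    off-OnA : ∀ d → OnA d ≡ false → FaceRep d ≡ FaceRep′ d
    off-OnA d e = FaceRep-unchanged d λ isd →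
      ((λ { refl → a↛d (SameFace-refl a) }) , (λ { refl → a↛d a→b })) , unchanged isd a↛d
      where
      a↛d : ¬ SameFace a d
      a↛d sf = false≢true (trans (sym e) (SameFace⇒inOrbit a d axy sf))

    old-faces : count (λ d → FaceRep d ∧ OnA d) pairs ≡ 1
    old-faces = ≤-antisym
      (count≤1 _ pairs pairs-unique λ d d′ cd cd′ → trans (counted≡rep d cd) (sym (counted≡rep d′ cd′)))
      (count≥1 _ pairs (rep a) (∈-pairs _) (rep-counted OnA axy (SameFace⇒inOrbit a _ axy (SameFace-rep a))))
      where
      counted≡rep : ∀ d → FaceRep d ∧ OnA d ≡ true → d ≡ rep a
      counted≡rep d counted =
        let fr , on = ∧-≡true⁻ {FaceRep d} counted
            isd , isr = ∧-≡true⁻ {adj G (proj₁ d) (proj₂ d)} fr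
        in isRep⇒≡rep a d axy (inOrbit⇒SameFace a d on) isr

    new-faces : ℕ
    new-faces = count (λ d → FaceRep′ d ∧ OnA d) pairs

    faces-split : #faces + new-faces ≡ #faces′ + 1
    faces-split = trans (faces-exchange OnA off-OnA) (cong (#faces′ +_) old-faces)

    -- each nonempty arc is one new face, represented by R′.rep of its first dart
    module NewFace (p : Dart) (Ip : IsDart p) (ℓ : ℕ) (avoids : ∀ t → 0 < t → t < ℓ → S.Avoids (iterate φ t p))
                   (exit : ∀ e → φ e ≡ iterate φ ℓ p → R′.φ e ≡ φ p) (a→p : SameFace a p) (1<ℓ : 1 < ℓ) where

      open S.Arc p ℓ avoids (φ p) exit
      open Cycle refl 1<ℓ

      φp′ : R′.IsDart (φ p)
      φp′ = dart′⁺ (φ-dart p Ip) (InArc⇒Avoids (first 1<ℓ))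

      r : Dart
      r = R′.rep (φ p)

      r-inArc : InArc r
      r-inArc = subst InArc (proj₂ (R′.SameFace-rep (φ p))) (closed (proj₁ (R′.SameFace-rep (φ p))))

      r-counted : FaceRep′ r ∧ OnA r ≡ true
      r-counted = rep′-counted OnA φp′ (SameFace⇒inOrbit a r axy
        (let t , _ , _ , e = r-inArc in SameFace-trans a→p (t , e)))

      inArc≡r : ∀ {d} → InArc d → R′.isRep d ≡ true → d ≡ r
      inArc≡r inArc isr = R′.isRep⇒≡rep (φ p) _ φp′ (proj₁ (connected inArc)) isr

    module FaceA = NewFace a axy m avoidsA (λ e fe≡fᵐa → φ′-before-b e (trans fe≡fᵐa fᵐa≡b)) (SameFace-refl a)
    module FaceB = NewFace b ayx (S.OrbitA.P ∸ m) avoidsB (λ e fe≡ → φ′-before-a e (trans fe≡ fᴾ⁻ᵐb≡a)) a→b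

    new-faces≤2 : new-faces ≤ 2
    new-faces≤2 = count≤2 _ pairs (R′.rep (φ a)) (R′.rep (φ b)) pairs-unique λ d counted →
      let fr , on = ∧-≡true⁻ {FaceRep′ d} counted
          isd′ , isr = ∧-≡true⁻ {adj G′ (proj₁ d) (proj₂ d)} fr
          _ , avoids = dart′⁻ isd′
      in case (covered (inOrbit⇒SameFace a d on) avoids) isr
      where
      case : ∀ {d} → ArcA.InArc d ⊎ ArcB.InArc d → R′.isRep d ≡ true → d ≡ R′.rep (φ a) ⊎ d ≡ R′.rep (φ b)
      case (inj₁ inA@(t , 0<t , t<m , _))  isr = inj₁ (FaceA.inArc≡r (<-≤-trans (s≤s 0<t) t<m) inA isr)
      case (inj₂ inB@(t , 0<t , t<ℓ , _)) isr = inj₂ (FaceB.inArc≡r (<-≤-trans (s≤s 0<t) t<ℓ) inB isr)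

    -- an empty arc means that the rotation at its end vertex has a single neighbour, now deleted
    x-isolated : ¬ 1 < S.OrbitA.P ∸ m → deg G′ x ≡ 0
    x-isolated 1≮ℓ = SkipX.σ-fixes-q⇒deg′≡0 (cong proj₂ (arcB-empty 1≮ℓ))

    y-isolated : ¬ 1 < m → deg G′ y ≡ 0
    y-isolated 1≮m = SkipY.σ-fixes-q⇒deg′≡0 (cong proj₂ (arcA-empty 1≮m))

    isolated-split : #isolated G + 2 ≤ new-faces + #isolated G′
    isolated-split with 1 <? m | 1 <? S.OrbitA.P ∸ m
    ... | yes 1<m | yes 1<ℓ = interchange {j = 2} {l = 0} (≤-trans (≤-reflexive (+-identityʳ _)) isolated-mono)
      (count≥2 _ pairs (FaceA.r 1<m) (FaceB.r 1<ℓ) (∈-pairs _) (FaceA.r-counted 1<m) (∈-pairs _) (FaceB.r-counted 1<ℓ)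
        λ rA≡rB → disjoint (FaceA.r-inArc 1<m) (subst ArcB.InArc (sym rA≡rB) (FaceB.r-inArc 1<ℓ)))
    ... | yes 1<m | no  1≮ℓ = interchange {j = 1} {l = 1} (isolated-x (x-isolated 1≮ℓ))
      (count≥1 _ pairs (FaceA.r 1<m) (∈-pairs _) (FaceA.r-counted 1<m))
    ... | no  1≮m | yes 1<ℓ = interchange {j = 1} {l = 1} (isolated-y (y-isolated 1≮m))
      (count≥1 _ pairs (FaceB.r 1<ℓ) (∈-pairs _) (FaceB.r-counted 1<ℓ))
    ... | no  1≮m | no  1≮ℓ = interchange {j = 0} {l = 2} (isolated-xy (x-isolated 1≮ℓ) (y-isolated 1≮m))
      (z≤n {new-faces})

module Reachability {n : ℕ} (G : Graph n) where

  open import Data.Fin.Properties using (pigeonhole; any?)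
  open import Data.Bool.Properties using () renaming (_≟_ to _≟ᵇ_)
  open import Data.Nat.Induction using (<-wellFounded)
  open import Induction.WellFounded using (Acc; acc)
  open GraphFacts G using (Adj-sym)

  length : ∀ {u v} → Reach G u v → ℕ
  length here       = 0
  length (step _ r) = suc (length r)

  _++_ : ∀ {u w v} → Reach G u w → Reach G w v → Reach G u v
  here       ++ q = q
  (step a p) ++ q = step a (p ++ q)

  length-++ : ∀ {u w v} (p : Reach G u w) (q : Reach G w v) → length (p ++ q) ≡ length p + length q
  length-++ here       q = refl
  length-++ (step a p) q = cong suc (length-++ p q)

  _∷ʳ_ : ∀ {u w v} → Reach G u w → Adj G w v → Reach G u v
  p ∷ʳ a = p ++ step a here

  reverse : ∀ {u v} → Reach G u v → Reach G v u
  reverse here       = here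
  reverse (step a r) = reverse r ∷ʳ Adj-sym a

  vertexAt : ∀ {u v} → Reach G u v → ℕ → Fin n
  vertexAt {u} here       _       = u
  vertexAt {u} (step a r) zero    = u
  vertexAt     (step a r) (suc i) = vertexAt r i

  prefix : ∀ {u v} (r : Reach G u v) i → Σ (Reach G u (vertexAt r i)) λ p → length p ≤ i
  prefix here       i       = here , z≤n
  prefix (step a r) zero    = here , z≤n
  prefix (step a r) (suc i) = let p , p≤i = prefix r i in step a p , s≤s p≤i

  suffix : ∀ {u v} (r : Reach G u v) j → j ≤ length r → Σ (Reach G (vertexAt r j) v) λ s → length s + j ≡ length r
  suffix here       zero    _       = here , refl
  suffix (step a r) zero    _       = step a r , +-identityʳ _
  suffix (step a r) (suc j) (s≤s j≤) = let s , e = suffix r j j≤ in s , trans (+-suc (length s) j) (cong suc e)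

  -- a path through at least n edges visits some vertex twice; cut out the loop
  shorten : ∀ {u v} (r : Reach G u v) → n ≤ length r → Σ (Reach G u v) λ r′ → length r′ < length r
  shorten {u} {v} r n≤len with pigeonhole ≤-refl (λ (k : Fin (suc n)) → vertexAt r (toℕ k))
  ... | i , j , i<j , same = p ++ s′ , (begin-strict
    length (p ++ s′)       ≡⟨ length-++ p s′ ⟩
    length p + length s′   ≡⟨ cong (length p +_) (length-subst same s) ⟩
    length p + length s    ≤⟨ +-monoˡ-≤ (length s) p≤i ⟩
    toℕ i + length s       <⟨ +-monoˡ-< (length s) i<j ⟩
    toℕ j + length s       ≡⟨ +-comm (toℕ j) (length s) ⟩
    length s + toℕ j       ≡⟨ s+j≡len ⟩
    length r               ∎)
    where
    open ≤-Reasoning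
    open import Data.Fin.Properties using (toℕ<n)
    p = proj₁ (prefix r (toℕ i))
    p≤i = proj₂ (prefix r (toℕ i))
    j≤len = ≤-trans (s≤s⁻¹ (toℕ<n j)) n≤len
    s = proj₁ (suffix r (toℕ j) j≤len)
    s+j≡len = proj₂ (suffix r (toℕ j) j≤len)
    s′ = subst (λ z → Reach G z v) (sym same) s
    length-subst : ∀ {z z′} (e : z ≡ z′) (t : Reach G z′ v) → length (subst (λ w → Reach G w v) (sym e) t) ≡ length t
    length-subst refl t = refl

  short-path : ∀ {u v} → Reach G u v → Σ (Reach G u v) λ r → length r < n
  short-path r = go r (<-wellFounded (length r))
    where
    go : ∀ {u v} (r : Reach G u v) → Acc _<_ (length r) → Σ (Reach G u v) λ r′ → length r′ < n
    go r (acc shorter) with length r <? n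
    ... | yes len<n = r , len<n
    ... | no  len≮n = let r′ , r′<r = shorten r (≮⇒≥ len≮n) in go r′ (shorter r′<r)

  Reach≤? : ∀ k u v → Dec (Σ (Reach G u v) λ r → length r ≤ k)
  Reach≤? k u v with u ≟ v
  ... | yes refl = yes (here , z≤n)
  Reach≤? zero    u v | no u≢v = no λ { (here , _) → u≢v refl ; (step _ _ , ()) }
  Reach≤? (suc k) u v | no u≢v with any? (λ w → (adj G u w ≟ᵇ true) ×-dec Reach≤? k w v)
  ... | yes (w , a , r , r≤k) = yes (step a r , s≤s r≤k)
  ... | no  none = no λ { (here , _) → u≢v refl ; (step {w = w} a r , s≤s r≤k) → none (w , a , r , r≤k) }

  Reach? : ∀ u v → Dec (Reach G u v)
  Reach? u v with Reach≤? n u v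
  ... | yes (r , _) = yes r
  ... | no  none    = no λ r → let r′ , r′<n = short-path r in none (r′ , <⇒≤ r′<n)

  Reach-mono : ∀ {H : Graph n} → (∀ {p q} → Adj H p q → Adj G p q) → ∀ {u v} → Reach H u v → Reach G u v
  Reach-mono H⊆G here       = here
  Reach-mono H⊆G (step a r) = step (H⊆G a) (Reach-mono H⊆G r)

module ComponentsAfterDeletion {n : ℕ} (G : Graph n) (σ : Fin n → Fin n → Fin n) (rot : IsRotation G σ)
                               (x y : Fin n) (axy : Adj G x y) where

  open import Data.Fin using (fromℕ; inject₁)
  open import Data.Fin.Properties using (fromℕ≢inject₁; inject₁-injective)
  open FacesAfterDeletion G σ rot x y axy
  module Path  = Reachability G
  module Path′ = Reachability G′
  open Path′ using (_++_; _∷ʳ_; reverse)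

  Reach′⇒Reach : ∀ {u v} → Reach G′ u v → Reach G u v
  Reach′⇒Reach = Path.Reach-mono Adj′⇒Adj

  data Detour (u v : Fin n) : Set where
    direct : Reach G′ u v → Detour u v
    via-xy : Reach G′ u x → Reach G′ y v → Detour u v
    via-yx : Reach G′ u y → Reach G′ x v → Detour u v

  detour : ∀ {u v} → Reach G u v → Detour u v
  detour here = direct here
  detour (step {u} {w} a r) with xy? u w | detour r
  ... | no ¬xy | direct r′    = direct (step (Adj′⁺ a ¬xy) r′)
  ... | no ¬xy | via-xy p q   = via-xy (step (Adj′⁺ a ¬xy) p) q
  ... | no ¬xy | via-yx p q   = via-yx (step (Adj′⁺ a ¬xy) p) q
  ... | yes (inj₁ (refl , refl)) | direct r′   = via-xy here r′
  ... | yes (inj₁ (refl , refl)) | via-xy _ q  = via-xy here q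
  ... | yes (inj₁ (refl , refl)) | via-yx _ q  = direct q
  ... | yes (inj₂ (refl , refl)) | direct r′   = via-yx here r′
  ... | yes (inj₂ (refl , refl)) | via-xy _ q  = direct q
  ... | yes (inj₂ (refl , refl)) | via-yx _ q  = via-yx here q

  Reach-if-x↝y : Reach G′ x y → ∀ {u v} → Reach G u v → Reach G′ u v
  Reach-if-x↝y x↝y r with detour r
  ... | direct r′ = r′
  ... | via-xy p q = p ++ (x↝y ++ q)
  ... | via-yx p q = p ++ (reverse x↝y ++ q)

  face-walk : ∀ k d → R′.IsDart d → Reach G′ (proj₁ d) (proj₁ (iterate R′.φ k d))
  face-walk zero    d isd = here
  face-walk (suc k) d isd = face-walk k d isd ∷ʳ R′.iterate-pres k d isd

  -- the merged face walks from y round to the dart that entered x along xy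
  y↝x-if-merged : ¬ SameFace a b → Reach G′ y x
  y↝x-if-merged a↛b with S.Merge.predecessor-of-a a↛b
  ... | e , φa→e@(k , φ′ᵏφa≡e) , φe≡a =
    subst (λ d → Reach G′ y (proj₁ d)) φ′ᵏφa≡e (face-walk k (φ a) φa′) ∷ʳ
      subst (Adj G′ (proj₁ e)) (cong proj₁ φe≡a) (R′.SameFace-dart φa′ φa→e)
    where
    φa′ = Merged.φa′ a↛b

  -- when xy was a bridge, the side of y becomes a new component, labelled by the new top element
  module Bridge (x↛y : ¬ Reach G′ x y) {c : ℕ} (comp : Fin n → Fin c) where

    open import Data.Fin.Relation.Unary.Top using (view; ‵fromℕ; ‵inject₁)

    comp′ : Fin n → Fin (suc c)
    comp′ v with Path′.Reach? v y
    ... | yes _ = fromℕ c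
    ... | no  _ = inject₁ (comp v)

    comp′-y : ∀ {v} → Reach G′ v y → comp′ v ≡ fromℕ c
    comp′-y {v} v↝y with Path′.Reach? v y
    ... | yes _   = refl
    ... | no  v↛y = ⊥-elim (v↛y v↝y)

    comp′-other : ∀ {v} → ¬ Reach G′ v y → comp′ v ≡ inject₁ (comp v)
    comp′-other {v} v↛y with Path′.Reach? v y
    ... | yes v↝y = ⊥-elim (v↛y v↝y)
    ... | no  _   = refl

    comp′-sound : (∀ u v → comp u ≡ comp v → Reach G u v) → ∀ u v → comp′ u ≡ comp′ v → Reach G′ u v
    comp′-sound sound u v same = cases (Path′.Reach? u y) (Path′.Reach? v y)
      where
      cases : Dec (Reach G′ u y) → Dec (Reach G′ v y) → Reach G′ u v
      cases (yes u↝y) (yes v↝y) = u↝y ++ reverse v↝y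
      cases (yes u↝y) (no  v↛y) = ⊥-elim (fromℕ≢inject₁ (trans (sym (comp′-y u↝y)) (trans same (comp′-other v↛y))))
      cases (no  u↛y) (yes v↝y) = ⊥-elim (fromℕ≢inject₁ (trans (sym (comp′-y v↝y)) (trans (sym same) (comp′-other u↛y))))
      cases (no  u↛y) (no  v↛y)
        with detour (sound u v (inject₁-injective (trans (sym (comp′-other u↛y)) (trans same (comp′-other v↛y)))))
      ... | direct r   = r
      ... | via-xy _ q = ⊥-elim (v↛y (reverse q))
      ... | via-yx p _ = ⊥-elim (u↛y p)

    comp′-complete : (∀ u v → Reach G u v → comp u ≡ comp v) → ∀ u v → Reach G′ u v → comp′ u ≡ comp′ v
    comp′-complete complete u v u↝v = cases (Path′.Reach? u y) (Path′.Reach? v y)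
      where
      cases : Dec (Reach G′ u y) → Dec (Reach G′ v y) → comp′ u ≡ comp′ v
      cases (yes u↝y) (yes v↝y) = trans (comp′-y u↝y) (sym (comp′-y v↝y))
      cases (yes u↝y) (no  v↛y) = ⊥-elim (v↛y (reverse u↝v ++ u↝y))
      cases (no  u↛y) (yes v↝y) = ⊥-elim (u↛y (u↝v ++ v↝y))
      cases (no  u↛y) (no  v↛y) = trans (comp′-other u↛y)
                                    (trans (cong inject₁ (complete u v (Reach′⇒Reach u↝v))) (sym (comp′-other v↛y)))

    comp′-surjective : (∀ u v → Reach G u v → comp u ≡ comp v) → (∀ i → ∃ λ v → comp v ≡ i) →
                       ∀ i → ∃ λ v → comp′ v ≡ i
    comp′-surjective complete surjective i with view i
    ... | ‵fromℕ     = y , comp′-y here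
    ... | ‵inject₁ j with surjective j
    ...   | v , comp-v≡j with Path′.Reach? v y
    ...     | no  v↛y = v , trans (comp′-other v↛y) (cong inject₁ comp-v≡j)
    ...     | yes v↝y = x , trans (comp′-other x↛y) (cong inject₁ (begin
      comp x ≡⟨ complete x y (step axy here) ⟩
      comp y ≡⟨ complete y v (Reach′⇒Reach (reverse v↝y)) ⟩
      comp v ≡⟨ comp-v≡j ⟩
      j      ∎))
      where open ≡-Reasoning

-- Euler's inequality for rotation systems

module EulerArithmetic where

  open import Data.Nat.Solver using (module +-*-Solver)
  open +-*-Solver using (solve; _:+_; _:*_; _:=_; con)

  n+[f+1]+i≡1+n+f+i : ∀ n f i → n + (f + 1) + i ≡ suc (n + f + i)
  n+[f+1]+i≡1+n+f+i = solve 3 (λ n f i → n :+ (f :+ con 1) :+ i := con 1 :+ (n :+ f :+ i)) refl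

  2+n+f+i≡n+f+[i+2] : ∀ n f i → 2 + (n + f + i) ≡ n + f + (i + 2)
  2+n+f+i≡n+f+[i+2] = solve 3 (λ n f i → con 2 :+ (n :+ f :+ i) := n :+ f :+ (i :+ con 2)) refl

  n+f+[k+i]≡n+[f+k]+i : ∀ n f k i → n + f + (k + i) ≡ n + (f + k) + i
  n+f+[k+i]≡n+[f+k]+i = solve 4 (λ n f k i → n :+ f :+ (k :+ i) := n :+ (f :+ k) :+ i) refl

  2+e+2c≡e+2[1+c] : ∀ e c → 2 + e + 2 * c ≡ e + 2 * suc c
  2+e+2c≡e+2[1+c] = solve 2 (λ e c → con 2 :+ e :+ con 2 :* c := e :+ con 2 :* (con 1 :+ c)) refl

module EulerInequality {n : ℕ} where

  open import Data.List using (allFin)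
  open import Data.List.Properties using (length-tabulate)
  open import Data.List.Membership.Propositional.Properties using (∈-allFin)
  open import Data.Fin.Properties using (injective⇒≤; toℕ-injective)
  open Counting
  open DartCounting
  open VertexPairs n
  open EulerArithmetic

  -- the genus of a rotation system is non-negative (comp may count components with repetitions)
  EulerBound : Graph n → Set
  EulerBound H = ∀ σ → IsRotation H σ → ∀ c (comp : Fin n → Fin c) → (∀ u v → comp u ≡ comp v → Reach H u v) →
                 n + Faces.#faces H σ + #isolated H ≤ ∣E∣ H + 2 * c

  no-ordered-edges : ∀ (H : Graph n) → ∣E∣ H ≡ 0 → ∀ {u v} → Adj H u v → ¬ toℕ u < toℕ v
  no-ordered-edges H none {u} {v} a u<v = 1+n≰n (≤-trans
    (count≥1 (GraphFacts.isEdge H) pairs (u , v) (∈-pairs _) (∧-≡true⁺ a (T⇒≡true (<⇒<ᵇ u<v)))) (≤-reflexive none))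

  no-edges : ∀ (H : Graph n) → ∣E∣ H ≡ 0 → ∀ {u v} → ¬ Adj H u v
  no-edges H none {u} {v} a with <-cmp (toℕ u) (toℕ v)
  ... | tri< u<v _ _ = no-ordered-edges H none a u<v
  ... | tri≈ _ u≡v _ = GraphFacts.Adj-irrefl H (subst (Adj H u) (sym (toℕ-injective u≡v)) a)
  ... | tri> _ _ v<u = no-ordered-edges H none (GraphFacts.Adj-sym H a) v<u

  edgeless-bound : ∀ (H : Graph n) → ∣E∣ H ≡ 0 → EulerBound H
  edgeless-bound H none σ rot c comp sound = begin
    n + Faces.#faces H σ + #isolated H ≡⟨ cong₂ (λ f i → n + f + i) no-faces all-isolated ⟩
    n + 0 + n                          ≡⟨ cong (_+ n) (+-identityʳ n) ⟩
    n + n                              ≤⟨ +-mono-≤ n≤c (≤-trans n≤c (≤-reflexive (sym (+-identityʳ c)))) ⟩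
    c + (c + 0)                        ≡⟨ cong (_+ 2 * c) (sym none) ⟩
    ∣E∣ H + 2 * c                      ∎
    where
    open ≤-Reasoning
    no-faces : Faces.#faces H σ ≡ 0
    no-faces = count-none _ pairs λ d _ counted → no-edges H none (proj₁ (∧-≡true⁻ {adj H (proj₁ d) (proj₂ d)} counted))
    all-isolated : #isolated H ≡ n
    all-isolated = trans (count-all _ (allFin n) λ v → cong (_≡ᵇ 0) (count-none (adj H v) (allFin n) λ _ _ → no-edges H none))
                         (length-tabulate (λ v → v))
    stays : ∀ {u v} → Reach H u v → u ≡ v
    stays here       = refl
    stays (step a _) = ⊥-elim (no-edges H none a)
    n≤c : n ≤ c
    n≤c = injective⇒≤ (λ same → stays (sound _ _ same))

  module DeletionStep (H : Graph n) (σ : Fin n → Fin n → Fin n) (rot : IsRotation H σ)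
                      (x y : Fin n) (axy : Adj H x y) (x<y : toℕ x < toℕ y) where

    open ComponentsAfterDeletion H σ rot x y axy
    open FacesAfterDeletion H σ rot x y axy
    open Path′ using (reverse; Reach?)

    bound-if-x↝y : EulerBound G′ → #faces ≤ #faces′ + 1 → Reach G′ x y → ∀ c comp →
                   (∀ u v → comp u ≡ comp v → Reach H u v) → n + #faces + #isolated H ≤ ∣E∣ H + 2 * c
    bound-if-x↝y bound′ f≤f′+1 x↝y c comp sound = begin
      n + #faces + #isolated H               ≤⟨ +-mono-≤ (+-monoʳ-≤ n f≤f′+1) isolated-mono ⟩
      n + (#faces′ + 1) + #isolated G′        ≡⟨ n+[f+1]+i≡1+n+f+i n #faces′ (#isolated G′) ⟩
      suc (n + #faces′ + #isolated G′)        ≤⟨ s≤s (bound′ σ′ rot′ c comp λ u v same → Reach-if-x↝y x↝y (sound u v same)) ⟩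
      suc (∣E∣ G′ + 2 * c)                    ≡⟨ cong (_+ 2 * c) (sym (∣E∣-delete x<y)) ⟩
      ∣E∣ H + 2 * c                           ∎
      where open ≤-Reasoning

    bound-if-bridge : EulerBound G′ → (a→b : SameFace a b) → ¬ Reach G′ x y → ∀ c comp →
                      (∀ u v → comp u ≡ comp v → Reach H u v) → n + #faces + #isolated H ≤ ∣E∣ H + 2 * c
    bound-if-bridge bound′ a→b x↛y c comp sound = +-cancelˡ-≤ 2 _ _ (begin
      2 + (n + #faces + #isolated H)         ≡⟨ 2+n+f+i≡n+f+[i+2] n #faces (#isolated H) ⟩
      n + #faces + (#isolated H + 2)         ≤⟨ +-monoʳ-≤ (n + #faces) isolated-split ⟩
      n + #faces + (new-faces + #isolated G′) ≡⟨ n+f+[k+i]≡n+[f+k]+i n #faces new-faces (#isolated G′) ⟩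
      n + (#faces + new-faces) + #isolated G′ ≡⟨ cong (λ f → n + f + #isolated G′) faces-split ⟩
      n + (#faces′ + 1) + #isolated G′        ≡⟨ n+[f+1]+i≡1+n+f+i n #faces′ (#isolated G′) ⟩
      suc (n + #faces′ + #isolated G′)        ≤⟨ s≤s (bound′ σ′ rot′ (suc c) comp′ (comp′-sound sound)) ⟩
      suc (∣E∣ G′ + 2 * suc c)                ≡⟨ cong suc (sym (2+e+2c≡e+2[1+c] (∣E∣ G′) c)) ⟩
      2 + (suc (∣E∣ G′) + 2 * c)              ≡⟨ cong (λ e → 2 + (e + 2 * c)) (sym (∣E∣-delete x<y)) ⟩
      2 + (∣E∣ H + 2 * c)                     ∎)
      where
      open ≤-Reasoning
      open Split a→b
      open Bridge x↛y comp

    bound : EulerBound G′ → ∀ c comp → (∀ u v → comp u ≡ comp v → Reach H u v) →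
            n + #faces + #isolated H ≤ ∣E∣ H + 2 * c
    bound bound′ with SameFace? a b axy
    ... | no a↛b = bound-if-x↝y bound′ (≤-reflexive (Merged.faces-merge a↛b)) (reverse (y↝x-if-merged a↛b))
    ... | yes a→b with Reach? x y
    ...   | yes x↝y = bound-if-x↝y bound′ (≤-trans (m≤m+n #faces _) (≤-reflexive (Split.faces-split a→b))) x↝y
    ...   | no  x↛y = bound-if-bridge bound′ a→b x↛y

  euler-bound′ : ∀ k (H : Graph n) → ∣E∣ H ≡ k → EulerBound H
  euler-bound′ zero    H none = edgeless-bound H none
  euler-bound′ (suc k) H e σ rot
    with count>0⇒witness (GraphFacts.isEdge H) pairs (subst (0 <_) (sym e) z<s)
  ... | (x , y) , xy-edge =
    let axy , x<ᵇy = ∧-≡true⁻ {adj H x y} xy-edge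
        x<y = <ᵇ⇒< (toℕ x) (toℕ y) (≡true⇒T x<ᵇy)
        open EdgeDeletion H x y axy using (G′; ∣E∣-delete)
    in DeletionStep.bound H σ rot x y axy x<y (euler-bound′ k G′ (suc-injective (trans (sym (∣E∣-delete x<y)) e)))

  euler-bound : ∀ (H : Graph n) → EulerBound H
  euler-bound H = euler-bound′ (∣E∣ H) H refl

-- Deleting an edge between two vertices of degree at least two preserves planarity

module PlanarityOfDeletion {n : ℕ} (G : Graph n) (σ : Fin n → Fin n → Fin n) (plane : IsPlaneRotation G σ)
                           (x y : Fin n) (axy : Adj G x y) (x<y : toℕ x < toℕ y)
                           (1<deg-x : 1 < deg G x) (1<deg-y : 1 < deg G y) where

  open import Function.Bundles using (mk⇔; Equivalence)
  open EulerArithmetic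

  rot : IsRotation G σ
  rot = proj₁ plane

  open ComponentsAfterDeletion G σ rot x y axy
  open FacesAfterDeletion G σ rot x y axy
  open Path′ using (reverse; Reach?)
  open EulerInequality using (euler-bound)

  c : ℕ
  c = proj₁ (proj₂ plane)

  comp : Fin n → Fin c
  comp = proj₁ (proj₂ (proj₂ plane))

  comp-surjective : ∀ i → ∃ λ v → comp v ≡ i
  comp-surjective = proj₁ (proj₂ (proj₂ (proj₂ plane)))

  comp-sound : ∀ u v → comp u ≡ comp v → Reach G u v
  comp-sound u v = Equivalence.to (proj₁ (proj₂ (proj₂ (proj₂ (proj₂ plane)))) u v)

  comp-complete : ∀ u v → Reach G u v → comp u ≡ comp v
  comp-complete u v = Equivalence.from (proj₁ (proj₂ (proj₂ (proj₂ (proj₂ plane)))) u v)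

  euler : n + #faces + #isolated G ≡ suc (∣E∣ G′) + 2 * c
  euler = trans (proj₂ (proj₂ (proj₂ (proj₂ (proj₂ plane))))) (cong (_+ 2 * c) (∣E∣-delete x<y))

  isolated′ : #isolated G′ ≡ #isolated G
  isolated′ = isolated-unchanged 1<deg-x 1<deg-y

  -- with no vertex isolated by the deletion, both arcs of a split face are nonempty
  faces-split-in-two : SameFace a b → #faces′ ≡ #faces + 1
  faces-split-in-two a→b = +-cancelʳ-≡ 1 _ _ (begin
    #faces′ + 1        ≡⟨ sym faces-split ⟩
    #faces + new-faces ≡⟨ cong (#faces +_) new-faces≡2 ⟩
    #faces + 2         ≡⟨ sym (+-assoc #faces 1 1) ⟩
    #faces + 1 + 1     ∎)
    where
    open ≡-Reasoning
    open Split a→b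
    new-faces≡2 : new-faces ≡ 2
    new-faces≡2 = ≤-antisym new-faces≤2 (+-cancelˡ-≤ (#isolated G) 2 new-faces (≤-trans isolated-split
      (≤-reflexive (trans (cong (new-faces +_) isolated′) (+-comm new-faces (#isolated G))))))

  planar-if-merged : ¬ SameFace a b → IsPlaneRotation G′ σ′
  planar-if-merged a↛b = rot′ , c , comp , comp-surjective ,
    (λ u v → mk⇔ (Reach-if-x↝y x↝y ∘ comp-sound u v) (comp-complete u v ∘ Reach′⇒Reach)) ,
    suc-injective (begin
      suc (n + #faces′ + #isolated G′) ≡⟨ sym (n+[f+1]+i≡1+n+f+i n #faces′ (#isolated G′)) ⟩
      n + (#faces′ + 1) + #isolated G′ ≡⟨ cong₂ (λ f i → n + f + i) (sym (Merged.faces-merge a↛b)) isolated′ ⟩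
      n + #faces + #isolated G         ≡⟨ euler ⟩
      suc (∣E∣ G′) + 2 * c             ∎)
    where
    open ≡-Reasoning
    x↝y = reverse (y↝x-if-merged a↛b)

  -- otherwise G′ would have genus −1
  split-keeps-x↛y : SameFace a b → ¬ Reach G′ x y
  split-keeps-x↛y a→b x↝y = <⇒≱ (begin-strict
    ∣E∣ G′ + 2 * c                   <⟨ n<1+n _ ⟩
    suc (∣E∣ G′ + 2 * c)             <⟨ n<1+n _ ⟩
    suc (suc (∣E∣ G′) + 2 * c)       ≡⟨ cong suc (sym euler) ⟩
    suc (n + #faces + #isolated G)   ≡⟨ sym (n+[f+1]+i≡1+n+f+i n #faces (#isolated G)) ⟩
    n + (#faces + 1) + #isolated G   ≡⟨ cong₂ (λ f i → n + f + i) (sym (faces-split-in-two a→b)) (sym isolated′) ⟩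
    n + #faces′ + #isolated G′       ∎)
    (euler-bound G′ σ′ rot′ c comp λ u v → Reach-if-x↝y x↝y ∘ comp-sound u v)
    where open ≤-Reasoning

  planar-if-bridge : SameFace a b → ¬ Reach G′ x y → IsPlaneRotation G′ σ′
  planar-if-bridge a→b x↛y = rot′ , suc c , comp′ , comp′-surjective comp-complete comp-surjective ,
    (λ u v → mk⇔ (comp′-sound comp-sound u v) (comp′-complete comp-complete u v)) ,
    (begin
      n + #faces′ + #isolated G′        ≡⟨ cong₂ (λ f i → n + f + i) (faces-split-in-two a→b) isolated′ ⟩
      n + (#faces + 1) + #isolated G    ≡⟨ n+[f+1]+i≡1+n+f+i n #faces (#isolated G) ⟩
      suc (n + #faces + #isolated G)    ≡⟨ cong suc euler ⟩
      suc (suc (∣E∣ G′) + 2 * c)        ≡⟨ 2+e+2c≡e+2[1+c] (∣E∣ G′) c ⟩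
      ∣E∣ G′ + 2 * suc c                ∎)
    where
    open ≡-Reasoning
    open Bridge x↛y comp

  planar′ : IsPlaneRotation G′ σ′
  planar′ with SameFace? a b axy
  ... | no  a↛b = planar-if-merged a↛b
  ... | yes a→b = planar-if-bridge a→b (split-keeps-x↛y a→b)

-- Two-distance colourings

module TwoDistanceColouring where

  open import Relation.Nullary using (¬?)
  open import Data.List using (List; []; _∷_; length; filterᵇ; allFin; _++_; concatMap; map)
  open import Data.List.Properties using (length-tabulate; length-++; length-map; filter-notAll)
  open import Data.List.Membership.Propositional using (_∈_)
  open import Data.List.Membership.Propositional.Properties using (∈-allFin; ∈-++⁺ˡ; ∈-++⁺ʳ; ∈-concatMap⁺; ∈-map⁺)
  open import Data.List.Relation.Unary.Any as Any using (here; there)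
  open import Data.List.Relation.Unary.Unique.Propositional.Properties using (allFin⁺)
  open import Data.Fin.Properties using (any?)

  free-colour : ∀ {k} (L : List (Fin k)) → length L < k → ∃ λ c → ¬ c ∈ L
  free-colour {k} L |L|<k with any? (λ c → ¬? (c ∈? L))
    where open import Data.List.Membership.DecPropositional (_≟_ {k}) using (_∈?_)
  ... | yes found = found
  ... | no  none  = ⊥-elim (<⇒≱ |L|<k (subst (_≤ length L) (length-tabulate (λ c → c))
      (unique-⊆⇒length≤ L (allFin⁺ k) λ {c} _ → decidable-stable (c ∈? L) λ c∉L → none (c , c∉L))))
    where
    open import Data.List.Membership.DecPropositional (_≟_ {k}) using (_∈?_)
    open VertexCounting using (unique-⊆⇒length≤)

  module SecondNeighbourhood {n : ℕ} (G : Graph n) where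

    open Counting
    open GraphFacts G using (Adj-sym)

    neighbours : Fin n → List (Fin n)
    neighbours v = filterᵇ (adj G v) (allFin n)

    others : Fin n → Fin n → List (Fin n)
    others v z = filterᵇ (λ t → not (does (t ≟ v))) (neighbours z)

    -- the vertices at distance one or two from v, other than v, with repetitions
    ball₂ : Fin n → List (Fin n)
    ball₂ v = neighbours v ++ concatMap (others v) (neighbours v)

    ∈-ball₂ : ∀ {v t} → ¬ v ≡ t → Dist≤2 G v t → t ∈ ball₂ v
    ∈-ball₂ {v} {t} v≢t (inj₁ avt) = ∈-++⁺ˡ (∈-filterᵇ⁺ (adj G v) (∈-allFin t) avt)
    ∈-ball₂ {v} {t} v≢t (inj₂ (z , avz , azt)) =
      ∈-++⁺ʳ (neighbours v) (∈-concatMap⁺ (others v) (Any.map (λ { refl → t∈others }) z∈neighbours))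
      where
      z∈neighbours = ∈-filterᵇ⁺ (adj G v) (∈-allFin z) avz
      t∈others = ∈-filterᵇ⁺ _ (∈-filterᵇ⁺ (adj G z) (∈-allFin t) azt) (cong not (dec-false (t ≟ v) (v≢t ∘ sym)))

    length-concatMap≤ : ∀ {A B : Set} (f : A → List B) K (zs : List A) → (∀ z → z ∈ zs → length (f z) ≤ K) →
                        length (concatMap f zs) ≤ length zs * K
    length-concatMap≤ f K []       bound = z≤n
    length-concatMap≤ f K (z ∷ zs) bound = ≤-trans (≤-reflexive (length-++ (f z)))
      (+-mono-≤ (bound z (here refl)) (length-concatMap≤ f K zs (λ w → bound w ∘ there)))

    length-ball₂ : ∀ {D} → MaxDeg≤ G (suc D) → ∀ v → length (ball₂ v) ≤ deg G v * suc D
    length-ball₂ {D} Δ≤1+D v = begin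
      length (ball₂ v)                    ≡⟨ length-++ (neighbours v) ⟩
      deg G v + length (concatMap (others v) (neighbours v))
        ≤⟨ +-monoʳ-≤ (deg G v) (length-concatMap≤ _ D (neighbours v) others≤D) ⟩
      deg G v + deg G v * D               ≡⟨ sym (*-suc (deg G v) D) ⟩
      deg G v * suc D                     ∎
      where
      open ≤-Reasoning
      others≤D : ∀ z → z ∈ neighbours v → length (others v z) ≤ D
      others≤D z z∈ = s≤s⁻¹ (≤-trans (filter-notAll _ (neighbours z)
        (Any.map (λ { refl → λ t≢v → false≢true (trans (sym (cong not (dec-true (v ≟ v) refl))) (T⇒≡true t≢v)) })
          (∈-filterᵇ⁺ (adj G z) (∈-allFin v) (Adj-sym (proj₂ (∈-filterᵇ⁻ (adj G v) {xs = allFin n} z∈))))))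
        (Δ≤1+D z))

  Dist≤2-sym : ∀ {n} {G : Graph n} {p q} → Dist≤2 G p q → Dist≤2 G q p
  Dist≤2-sym {G = G} (inj₁ apq)             = inj₁ (GraphFacts.Adj-sym G apq)
  Dist≤2-sym {G = G} (inj₂ (z , apz , azq)) = inj₂ (z , GraphFacts.Adj-sym G azq , GraphFacts.Adj-sym G apz)

  -- after deleting xy only pairs involving x or y lose their constraint, so only x and y are recoloured
  module RecolourEndpoints {n : ℕ} (G : Graph n) (x y : Fin n) (axy : Adj G x y) where

    open EdgeDeletion G x y axy
    open SecondNeighbourhood G

    Dist≤2-delete : ∀ {p q} → ¬ p ≡ x → ¬ p ≡ y → ¬ q ≡ x → ¬ q ≡ y → Dist≤2 G p q → Dist≤2 G′ p q
    Dist≤2-delete p≢x p≢y q≢x q≢y (inj₁ apq) = inj₁ (Adj′⁺ apq (IsXY-other p≢x p≢y))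
    Dist≤2-delete p≢x p≢y q≢x q≢y (inj₂ (z , apz , azq)) =
      inj₂ (z , Adj′⁺ apz (IsXY-other p≢x p≢y) , Adj′⁺ azq (IsXY-other q≢x q≢y ∘ IsXY-sym))

    recolour : ∀ {D k} → MaxDeg≤ G (suc D) → deg G x * suc D + 2 ≤ k → deg G y * suc D + 2 ≤ k →
               TwoDistColorable G′ k → TwoDistColorable G k
    recolour {D} {k} Δ≤1+D x-room y-room (φ′ , φ′-ok) = colour , colour-ok
      where
      open ≤-Reasoning

      cy-free = free-colour (map φ′ (ball₂ y)) (begin-strict
        length (map φ′ (ball₂ y)) ≡⟨ length-map φ′ (ball₂ y) ⟩
        length (ball₂ y)          ≤⟨ length-ball₂ Δ≤1+D y ⟩
        deg G y * suc D           <⟨ m<m+n _ z<s ⟩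
        deg G y * suc D + 2       ≤⟨ y-room ⟩
        k                         ∎)
      cy = proj₁ cy-free

      cx-free = free-colour (cy ∷ map φ′ (ball₂ x)) (begin-strict
        suc (length (map φ′ (ball₂ x))) ≡⟨ cong suc (length-map φ′ (ball₂ x)) ⟩
        suc (length (ball₂ x))          ≤⟨ s≤s (length-ball₂ Δ≤1+D x) ⟩
        suc (deg G x * suc D)           <⟨ ≤-reflexive (+-comm 2 _) ⟩
        deg G x * suc D + 2             ≤⟨ x-room ⟩
        k                               ∎)
      cx = proj₁ cx-free

      colour : Fin n → Fin k
      colour v with position v
      ... | at-x _      = cx
      ... | at-y _      = cy
      ... | other _ _   = φ′ v

      cx≢cy : ¬ cx ≡ cy
      cx≢cy cx≡cy = proj₂ cx-free (here cx≡cy)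

      cx-fresh : ∀ {t} → ¬ t ≡ x → Dist≤2 G x t → ¬ cx ≡ φ′ t
      cx-fresh t≢x d cx≡ = proj₂ cx-free (there (subst (_∈ map φ′ (ball₂ x)) (sym cx≡) (∈-map⁺ φ′ (∈-ball₂ (t≢x ∘ sym) d))))

      cy-fresh : ∀ {t} → ¬ t ≡ y → Dist≤2 G y t → ¬ cy ≡ φ′ t
      cy-fresh t≢y d cy≡ = proj₂ cy-free (subst (_∈ map φ′ (ball₂ y)) (sym cy≡) (∈-map⁺ φ′ (∈-ball₂ (t≢y ∘ sym) d)))

      colour-ok : ∀ p q → ¬ p ≡ q → Dist≤2 G p q → ¬ colour p ≡ colour q
      colour-ok p q p≢q d with position p | position q
      ... | at-x refl | at-x refl = λ _ → p≢q refl
      ... | at-x refl | at-y refl = cx≢cy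
      ... | at-x refl | other q≢x _ = cx-fresh q≢x d
      ... | at-y refl | at-x refl = cx≢cy ∘ sym
      ... | at-y refl | at-y refl = λ _ → p≢q refl
      ... | at-y refl | other _ q≢y = cy-fresh q≢y d
      ... | other p≢x _ | at-x refl = cx-fresh p≢x (Dist≤2-sym {G = G} d) ∘ sym
      ... | other _ p≢y | at-y refl = cy-fresh p≢y (Dist≤2-sym {G = G} d) ∘ sym
      ... | other p≢x p≢y | other q≢x q≢y = φ′-ok p q p≢q (Dist≤2-delete p≢x p≢y q≢x q≢y d)

-- Independent vertices on a face

module FaceBoundary {n : ℕ} (G : Graph n) (σ : Fin n → Fin n → Fin n) (rot : IsRotation G σ)
                    (d : Fin n × Fin n) (isd : Adj G (proj₁ d) (proj₂ d)) where

  open import Data.List using (List; []; _∷_; length; filterᵇ; allFin; map; _++_)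
  open import Data.List.Properties using (length-++; length-map)
  open import Data.List.Membership.Propositional using (_∈_)
  open import Data.List.Membership.Propositional.Properties using (∈-allFin; ∈-map⁻; ∈-++⁻)
  open import Data.List.Relation.Unary.Any using (here; there)
  open import Data.List.Relation.Unary.All as All using ()
  open import Data.List.Relation.Unary.Unique.Propositional using (Unique)
  open import Data.List.Relation.Unary.Unique.Propositional.Properties as Unique using (allFin⁺)
  open import Data.Fin.Properties using (any?; toℕ-injective)
  open import Data.Bool.Properties using (∨-zeroʳ)
  open RotationSystem G σ rot
  open GraphFacts G using (Adj-sym; Adj⇒≢; anyB⇒witness)
  open VertexPairs n
  open Counting

  OnBoundary : Fin n × Fin n → Bool
  OnBoundary (u , v) = adj G u v ∧ (toℕ u <ᵇ toℕ v) ∧ (inOrbit d (u , v) ∨ inOrbit d (v , u))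

  boundary : List (Fin n × Fin n)
  boundary = filterᵇ OnBoundary pairs

  edge : Fin n → Fin n → Fin n × Fin n
  edge u v = if toℕ u <ᵇ toℕ v then (u , v) else (v , u)

  edge-cases : ∀ u v → (edge u v ≡ (u , v) × toℕ u < toℕ v) ⊎ (edge u v ≡ (v , u) × ¬ toℕ u < toℕ v)
  edge-cases u v with toℕ u <ᵇ toℕ v in u<ᵇv
  ... | true  = inj₁ (refl , <ᵇ⇒< _ _ (≡true⇒T u<ᵇv))
  ... | false = inj₂ (refl , λ u<v → false≢true (trans (sym u<ᵇv) (T⇒≡true (<⇒<ᵇ u<v))))

  edge-injective : ∀ {u v u′ v′} → edge u v ≡ edge u′ v′ → (u ≡ u′ × v ≡ v′) ⊎ (u ≡ v′ × v ≡ u′)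
  edge-injective {u} {v} {u′} {v′} e with edge-cases u v | edge-cases u′ v′
  ... | inj₁ (e₁ , _) | inj₁ (e₂ , _) = let e′ = trans (sym e₁) (trans e e₂) in inj₁ (cong proj₁ e′ , cong proj₂ e′)
  ... | inj₁ (e₁ , _) | inj₂ (e₂ , _) = let e′ = trans (sym e₁) (trans e e₂) in inj₂ (cong proj₁ e′ , cong proj₂ e′)
  ... | inj₂ (e₁ , _) | inj₁ (e₂ , _) = let e′ = trans (sym e₁) (trans e e₂) in inj₂ (cong proj₂ e′ , cong proj₁ e′)
  ... | inj₂ (e₁ , _) | inj₂ (e₂ , _) = let e′ = trans (sym e₁) (trans e e₂) in inj₁ (cong proj₂ e′ , cong proj₁ e′)

  edge-on-boundary : ∀ {u v} → Adj G u v → SameFace d (u , v) → edge u v ∈ boundary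
  edge-on-boundary {u} {v} auv d→uv with edge-cases u v
  ... | inj₁ (e , u<v) = subst (_∈ boundary) (sym e) (∈-filterᵇ⁺ OnBoundary (∈-pairs _)
          (∧-≡true⁺ auv (∧-≡true⁺ (T⇒≡true (<⇒<ᵇ u<v)) (cong (_∨ inOrbit d (v , u)) (SameFace⇒inOrbit d _ isd d→uv)))))
  ... | inj₂ (e , u≮v) = subst (_∈ boundary) (sym e) (∈-filterᵇ⁺ OnBoundary (∈-pairs _)
          (∧-≡true⁺ (Adj-sym auv) (∧-≡true⁺ (T⇒≡true (<⇒<ᵇ v<u))
            (trans (cong (inOrbit d (v , u) ∨_) (SameFace⇒inOrbit d _ isd d→uv)) (∨-zeroʳ _)))))
    where
    v<u : toℕ v < toℕ u
    v<u with <-cmp (toℕ v) (toℕ u)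
    ... | tri< v<u _ _ = v<u
    ... | tri≈ _ v≡u _ = ⊥-elim (Adj⇒≢ auv (sym (toℕ-injective v≡u)))
    ... | tri> _ _ u<v = ⊥-elim (u≮v u<v)

  module Independent (P : Fin n → Bool)
                     (independent : ∀ {u w} → Adj G u w → P u ≡ true → P w ≡ true → ⊥)
                     (P⇒2≤deg : ∀ {w} → P w ≡ true → 2 ≤ deg G w) where

    OnFace : Fin n → Bool
    OnFace w = incident d w ∧ P w

    W : List (Fin n)
    W = filterᵇ OnFace (allFin n)

    out : Fin n → Fin n
    out w with any? (λ v → Data.Bool.T? (adj G w v ∧ inOrbit d (w , v)))
    ... | yes (v , _) = v
    ... | no  _       = w

    out-spec : ∀ {w} → incident d w ≡ true → Adj G w (out w) × SameFace d (w , out w)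
    out-spec {w} inc with any? (λ v → Data.Bool.T? (adj G w v ∧ inOrbit d (w , v)))
    ... | yes (v , found) = let a , o = ∧-≡true⁻ {adj G w v} (T⇒≡true found) in a , inOrbit⇒SameFace d _ o
    ... | no  none = let v , _ , found = anyB⇒witness _ (allFin n) inc in ⊥-elim (none (v , ≡true⇒T found))

    -- the vertex before out w in the rotation at w, so that the face enters w from it
    into : Fin n → Fin n
    into w with any? (λ t → Data.Bool.T? (adj G w t) ×-dec (σ w t ≟ out w))
    ... | yes (t , _) = t
    ... | no  _       = w

    into-spec : ∀ {w} → incident d w ≡ true → Adj G w (into w) × σ w (into w) ≡ out w
    into-spec {w} inc with any? (λ t → Data.Bool.T? (adj G w t) ×-dec (σ w t ≟ out w))
    ... | yes (t , at , e) = T⇒≡true at , e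
    ... | no  none = ⊥-elim (none (iterate (σ w) m (out w) , ≡true⇒T (σ-iterate-neighbour aw m) , σᵐ⁺¹≡))
      where
      aw = proj₁ (out-spec inc)
      m = proj₁ (σ-period aw)
      σᵐ⁺¹≡ = proj₂ (σ-period aw)

    InW : Fin n → Set
    InW w = incident d w ≡ true × P w ≡ true

    ∈W⇒InW : ∀ {w} → w ∈ W → InW w
    ∈W⇒InW w∈W = ∧-≡true⁻ (proj₂ (∈-filterᵇ⁻ OnFace {xs = allFin n} w∈W))

    into-on-face : ∀ {w} → incident d w ≡ true → SameFace d (into w , w)
    into-on-face {w} inc = let a , e = into-spec inc in
      SameFace-trans (proj₂ (out-spec inc)) (SameFace-sym (Adj-sym a) (1 , cong (w ,_) e))

    into≢out : ∀ {w} → InW w → ¬ into w ≡ out w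
    into≢out {w} (inc , pw) into≡out = <⇒≱ (P⇒2≤deg pw)
      (VertexCounting.count≤1 (adj G w) (allFin n) (allFin⁺ n) λ u u′ au au′ → trans (sole au) (sym (sole au′)))
      where
      aw = proj₁ (out-spec inc)
      sole : ∀ {u} → Adj G w u → u ≡ out w
      sole = σ-fixed⇒sole-neighbour aw (trans (cong (σ w) (sym into≡out)) (proj₂ (into-spec inc)))

    outEdge inEdge : Fin n → Fin n × Fin n
    outEdge w = edge w (out w)
    inEdge  w = edge (into w) w

    outEdge-injective : ∀ {w w′} → InW w → InW w′ → outEdge w ≡ outEdge w′ → w ≡ w′
    outEdge-injective {w} {w′} (inc , pw) (_ , pw′) e with edge-injective e
    ... | inj₁ (w≡w′ , _) = w≡w′
    ... | inj₂ (_ , out-w≡w′) = ⊥-elim (independent (subst (Adj G w) out-w≡w′ (proj₁ (out-spec inc))) pw pw′)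

    inEdge-injective : ∀ {w w′} → InW w → InW w′ → inEdge w ≡ inEdge w′ → w ≡ w′
    inEdge-injective {w} {w′} (inc , pw) (_ , pw′) e with edge-injective e
    ... | inj₁ (_ , w≡w′) = w≡w′
    ... | inj₂ (into-w≡w′ , _) = ⊥-elim (independent (subst (Adj G w) into-w≡w′ (proj₁ (into-spec inc))) pw pw′)

    outEdge≢inEdge : ∀ {w w′} → InW w → InW w′ → ¬ outEdge w ≡ inEdge w′
    outEdge≢inEdge {w} {w′} iw@(inc , pw) (inc′ , pw′) e with edge-injective e
    ... | inj₁ (w≡into-w′ , _) = independent (subst (Adj G w′) (sym w≡into-w′) (proj₁ (into-spec inc′))) pw′ pw
    ... | inj₂ (refl , out≡into) = into≢out iw (sym out≡into)

    edges : List (Fin n × Fin n)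
    edges = map outEdge W ++ map inEdge W

    edges-unique : Unique edges
    edges-unique = Unique.++⁺
      (unique-map-on outEdge InW InW-all W-unique outEdge-injective)
      (unique-map-on inEdge InW InW-all W-unique inEdge-injective)
      λ (e∈out , e∈in) → let w , w∈ , e≡ = ∈-map⁻ outEdge e∈out
                             w′ , w′∈ , e≡′ = ∈-map⁻ inEdge e∈in
                         in outEdge≢inEdge (∈W⇒InW w∈) (∈W⇒InW w′∈) (trans (sym e≡) e≡′)
      where
      W-unique = Unique.filter⁺ (Data.Bool.T? ∘ OnFace) (allFin⁺ n)
      InW-all = All.tabulate ∈W⇒InW

    edges⊆boundary : ∀ {e} → e ∈ edges → e ∈ boundary
    edges⊆boundary e∈ with ∈-++⁻ (map outEdge W) e∈
    ... | inj₁ e∈out with ∈-map⁻ outEdge e∈out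
    ...   | w , w∈ , refl = let inc = proj₁ (∈W⇒InW w∈) in
      edge-on-boundary (proj₁ (out-spec inc)) (proj₂ (out-spec inc))
    edges⊆boundary e∈ | inj₂ e∈in with ∈-map⁻ inEdge e∈in
    ...   | w , w∈ , refl = let inc = proj₁ (∈W⇒InW w∈) in
      edge-on-boundary (Adj-sym (proj₁ (into-spec inc))) (into-on-face inc)

    count*2≤faceDeg : count OnFace (allFin n) * 2 ≤ faceDeg d
    count*2≤faceDeg = begin
      length W * 2                                    ≡⟨ *-comm (length W) 2 ⟩
      length W + (length W + 0)                       ≡⟨ cong (length W +_) (+-identityʳ _) ⟩
      length W + length W                             ≡⟨ sym (cong₂ _+_ (length-map outEdge W) (length-map inEdge W)) ⟩
      length (map outEdge W) + length (map inEdge W)  ≡⟨ sym (length-++ (map outEdge W)) ⟩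
      length edges                                    ≤⟨ DartCounting.unique-⊆⇒length≤ boundary edges-unique edges⊆boundary ⟩
      length boundary                                 ∎
      where
      open ≤-Reasoning

module MinimalCounterexampleFacts {n : ℕ} (G : Graph n) (mc : MinimalCounterexample G) where

  open import Data.Fin.Properties using (toℕ-injective)
  open GraphFacts G using (Adj-sym; Adj⇒≢)
  open TwoDistanceColouring

  σ : Fin n → Fin n → Fin n
  σ = proj₁ (proj₁ mc)

  plane : IsPlaneRotation G σ
  plane = proj₂ (proj₁ mc)

  Δ≤6 : MaxDeg≤ G 6
  Δ≤6 = proj₁ (proj₂ mc)

  uncolourable : ¬ TwoDistColorable G 20
  uncolourable = proj₁ (proj₂ (proj₂ mc))

  minimal : ∀ m (H : Graph m) → Planar H → MaxDeg≤ H 6 → m + ∣E∣ H < n + ∣E∣ G → TwoDistColorable H 20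
  minimal = proj₂ (proj₂ (proj₂ mc))

  no-edge-between-3-vertices : ∀ x y → Adj G x y → toℕ x < toℕ y → deg G x ≡ 3 → deg G y ≡ 3 → ⊥
  no-edge-between-3-vertices x y axy x<y dx≡3 dy≡3 =
    uncolourable (recolour Δ≤6 (room dx≡3) (room dy≡3) (minimal n G′ (σ′ , planar′) Δ′≤6 smaller))
    where
    open EdgeDeletion G x y axy
    open Rotation σ (proj₁ plane) using (σ′)
    open RecolourEndpoints G x y axy using (recolour)
    open PlanarityOfDeletion G σ plane x y axy x<y (subst (1 <_) (sym dx≡3) (s≤s (s≤s z≤n)))
                                                   (subst (1 <_) (sym dy≡3) (s≤s (s≤s z≤n))) using (planar′)
    room : ∀ {v} → deg G v ≡ 3 → deg G v * 6 + 2 ≤ 20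
    room d≡3 = ≤-reflexive (cong (λ d → d * 6 + 2) d≡3)
    Δ′≤6 : MaxDeg≤ G′ 6
    Δ′≤6 v = ≤-trans (deg′≤deg v) (Δ≤6 v)
    smaller : n + ∣E∣ G′ < n + ∣E∣ G
    smaller = +-monoʳ-< n (≤-reflexive (sym (∣E∣-delete x<y)))

  degree-3-independent : ∀ {u w} → Adj G u w → deg G u ≡ 3 → deg G w ≡ 3 → ⊥
  degree-3-independent {u} {w} auw du≡3 dw≡3 with <-cmp (toℕ u) (toℕ w)
  ... | tri< u<w _ _ = no-edge-between-3-vertices u w auw u<w du≡3 dw≡3
  ... | tri≈ _ u≡w _ = Adj⇒≢ auw (toℕ-injective u≡w)
  ... | tri> _ _ w<u = no-edge-between-3-vertices w u (Adj-sym auw) w<u dw≡3 du≡3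

corollary15 : ∀ {n : ℕ} (G : Graph n) → MinimalCounterexample G →
    ∀ (σ : Fin n → Fin n → Fin n) → IsPlaneRotation G σ →
    ∀ (u v : Fin n) → Adj G u v →
    6 ≤ Faces.faceDeg G σ (u , v) →
    Faces.#deg3On G σ (u , v) ≤ Faces.faceDeg G σ (u , v) / 2
corollary15 G mc σ plane u v auv _ =
  subst (_≤ Faces.faceDeg G σ (u , v) / 2) (m*n/n≡m _ 2) (/-monoˡ-≤ 2 count*2≤faceDeg)
  where
  open import Data.Nat.DivMod using (m*n/n≡m; /-monoˡ-≤)
  open MinimalCounterexampleFacts G mc using (degree-3-independent)
  is-3 : ∀ {m} → (m ≡ᵇ 3) ≡ true → m ≡ 3
  is-3 {m} e = ≡ᵇ⇒≡ m 3 (≡true⇒T e)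
  open FaceBoundary G σ (proj₁ plane) (u , v) auv
  open Independent (λ w → deg G w ≡ᵇ 3) (λ a du dw → degree-3-independent a (is-3 du) (is-3 dw))
                   (λ dw → ≤-trans (s≤s (s≤s z≤n)) (≤-reflexive (sym (is-3 dw))))
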